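{- For integers $k\ge1$ and $1\le r\le n$, $$t(n,k,r)=\sum_{p=0}^{n-r}\binom{n-1}{p}\,t(p+1,k,1)\,t(n-p-1,k,r-1),$$ and for $k\ge2$, $n\ge1$, $$t(n,k,1)=\sum_{\lambda\vdash n}(-1)^{l(\lambda)+1}g_\lambda\prod_{i=1}^{l(\lambda)}t(\lambda_i,k-1,1),$$ with $t(0,k,0)=t(1,k,1)=1$.
   Context: $s(a,b)$ are the signed Stirling numbers of the first kind, $x(x-1)\cdots(x-a+1)=\sum_b s(a,b)x^b$, and $t(n,k,r)=\sum\prod_{j=1}^{k}s(i_{j-1},i_j)$ over integer tuples $n\ge i_1\ge\dots\ge i_{k-1}\ge r$ with $i_0=n$, $i_k=r$ (so $t(m,k,0)=0$ for $m\ge1$). For a partition $\lambda=(\lambda_1\ge\dots\ge\lambda_l>0)$ of $n$ (written $\lambda\vdash n$) with length $l(\lambda)=l$ and $m_j$ parts equal to $j$, $f_\lambda=\frac{n!}{\prod_{j}(j!)^{m_j}m_j!}$ and $g_\lambda=(l(\lambda)-1)!\,f_\lambda$. -}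

module Defs where

open import Data.Nat as ℕ using (ℕ; zero; suc; _∸_; _≡ᵇ_; _≤ᵇ_; NonZero)
open import Data.Nat.Properties using (_!≢0; m*n≢0; m^n≢0)
open import Data.Nat.Combinatorics using (_C_)
open import Data.Nat.DivMod using (_/_)
open import Data.Integer as ℤ using (ℤ; +_; -_; _+_; _*_)
open import Data.Bool using (Bool; true; false; _∧_; if_then_else_)
open import Data.List using (List; []; _∷_; map; concatMap; filterᵇ; length; applyUpTo; foldr)
open import Data.Nat.ListAction using () renaming (sum to sumℕ)

-- Integer polynomials as coefficient lists (constant term first)

Poly : Set
Poly = List ℤ

_+ₚ_ : Poly → Poly → Poly
[] +ₚ q = q
(a ∷ p) +ₚ [] = a ∷ p
(a ∷ p) +ₚ (b ∷ q) = (a + b) ∷ (p +ₚ q)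

scaleₚ : ℤ → Poly → Poly
scaleₚ c = map (c *_)

mulXminus : ℤ → Poly → Poly
mulXminus c p = (+ 0 ∷ p) +ₚ scaleₚ (- c) p

coeff : Poly → ℕ → ℤ
coeff []      _       = + 0
coeff (a ∷ p) zero    = a
coeff (a ∷ p) (suc b) = coeff p b

fallingPoly : ℕ → Poly
fallingPoly zero    = + 1 ∷ []
fallingPoly (suc a) = mulXminus (+ a) (fallingPoly a)

-- signed Stirling numbers of the first kind: x(x-1)...(x-a+1) = Σ_b s(a,b) x^b
s : ℕ → ℕ → ℤ
s a b = coeff (fallingPoly a) b

Σ[0…_] : ℕ → (ℕ → ℤ) → ℤ
Σ[0…_] zero    f = f 0
Σ[0…_] (suc m) f = Σ[0…_] m f + f (suc m)

sumℤ : List ℤ → ℤ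
sumℤ = foldr _+_ (+ 0)

prodℤ : List ℤ → ℤ
prodℤ = foldr _*_ (+ 1)

-- t(n,k,r) = Σ over n ≥ i_1 ≥ … ≥ i_{k-1} ≥ r of Π_{j=1}^k s(i_{j-1}, i_j),
-- with i_0 = n, i_k = r.

t : ℕ → ℕ → ℕ → ℤ
t n zero    r = if n ≡ᵇ r then + 1 else + 0
t n (suc k) r = if r ≤ᵇ n then Σ[0…_] (n ∸ r) (λ q → s n (r ℕ.+ q) * t (r ℕ.+ q) k r) else + 0

-- Integer partitions, represented as lists of parts λ₁ ≥ … ≥ λ_l > 0

nonincreasing : List ℕ → Bool
nonincreasing []           = true
nonincreasing (a ∷ [])     = true
nonincreasing (a ∷ b ∷ xs) = (b ≤ᵇ a) ∧ nonincreasing (b ∷ xs)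

listsOf : ℕ → ℕ → List (List ℕ)
listsOf n zero      = [] ∷ []
listsOf n (suc len) = concatMap (λ j → map (suc j ∷_) (listsOf n len)) (applyUpTo (λ i → i) n)

-- all partitions λ ⊢ n : nonincreasing lists of positive parts summing to n
-- (every such list has length ≤ n and parts ≤ n)
partitions : ℕ → List (List ℕ)
partitions n =
  filterᵇ (λ λs → nonincreasing λs ∧ (sumℕ λs ≡ᵇ n))
          (concatMap (listsOf n) (applyUpTo (λ i → i) (suc n)))

mult : List ℕ → ℕ → ℕ
mult λs j = length (filterᵇ (λ x → x ≡ᵇ j) λs)

denom : ℕ → List ℕ → ℕ
denom zero    λs = 1
denom (suc j) λs = denom j λs ℕ.* ((((suc j) ℕ.!) ℕ.^ mult λs (suc j)) ℕ.* (mult λs (suc j)) ℕ.!)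

denom≢0 : ∀ j λs → NonZero (denom j λs)
denom≢0 zero λs = _
denom≢0 (suc j) λs =
  m*n≢0 (denom j λs) _ {{denom≢0 j λs}}
    {{m*n≢0 _ _ {{m^n≢0 _ (mult λs (suc j)) {{(suc j) !≢0}}}} {{(mult λs (suc j)) !≢0}}}}

f : ℕ → List ℕ → ℕ
f n λs = (n ℕ.! / denom n λs) {{denom≢0 n λs}}

g : ℕ → List ℕ → ℕ
g n λs = (length λs ∸ 1) ℕ.! ℕ.* f n λs

negOnePow : ℕ → ℤ
negOnePow zero    = + 1
negOnePow (suc m) = - negOnePow m

{-# OPTIONS --safe #-}
-- Let S = (s(n, m)) be the lower-triangular Stirling matrix, so that t(·, k, ·) = S^k.  S is the
-- Jabotinsky matrix of log(1 + x), i.e. S(n, m) = n! [xⁿ] F(x)^m / m! with F(0) = 0, and such matrices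
-- are characterised by
--   A(n+1, q+d+1) C(q+d, q) = ∑_p C(n, p) A(p+1, q+1) A(n−p, d),
-- the coefficientwise form of (F^{q+d+1}/(q+d+1)!)′ = F′ F^q/q! · F^d/d!.  This identity is preserved
-- under matrix products, and for S^k and q = 0 it is the first claim.  With q = 0 it also determines A
-- from its first column a(j) = A(j, 1), giving the partial Bell polynomial expansion
--   A(n, m) = ∑_{λ ⊢ n, l(λ) = m} f_λ ∏ a(λ_i),
-- proved by induction on the largest admissible part: the parts equal to it split off as a factor of
-- the exponential generating function.  Inserting this for A = S^{k−1} into
-- t(n, k, 1) = ∑_m t(n, k−1, m) s(m, 1), where s(m, 1) = (−1)^{m−1} (m−1)!, gives the second claim.
module Submission where

module FiniteSum where

  open import Data.Nat as ℕ using (ℕ; zero; suc; _≤_; _<_; _∸_)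
  import Data.Nat.Properties as ℕ
  open import Data.Integer using (ℤ; +_; _+_; _*_)
  open import Data.Integer.Properties
    using (+-identityˡ; +-identityʳ; +-assoc; *-zeroʳ; *-distribˡ-+; *-comm)
  open import Data.Sum using (inj₁; inj₂)
  open import Function using (_∘_)
  open import Relation.Binary.PropositionalEquality
  open import Relation.Nullary using (¬_)
  open import Data.Integer.Tactic.RingSolver using (solve-∀)
  open import Defs using (Σ[0…_])

  ∑ : ℕ → (ℕ → ℤ) → ℤ
  ∑ zero    f = + 0
  ∑ (suc n) f = ∑ n f + f n

  syntax ∑ n (λ i → e) = ∑[ i < n ] e

  Σ[0…]≡∑ : ∀ m f → Σ[0…_] m f ≡ ∑[ i < suc m ] f i
  Σ[0…]≡∑ zero    f = sym (+-identityˡ (f 0))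
  Σ[0…]≡∑ (suc m) f = cong (_+ f (suc m)) (Σ[0…]≡∑ m f)

  ∑-cong : ∀ n {f g} → (∀ {i} → i < n → f i ≡ g i) → ∑ n f ≡ ∑ n g
  ∑-cong zero    f≡g = refl
  ∑-cong (suc n) f≡g = cong₂ _+_ (∑-cong n (f≡g ∘ ℕ.m<n⇒m<1+n)) (f≡g ℕ.≤-refl)

  ∑-cong-≗ : ∀ n {f g} → f ≗ g → ∑ n f ≡ ∑ n g
  ∑-cong-≗ n f≗g = ∑-cong n (λ {i} _ → f≗g i)

  ∑-zero : ∀ n {f} → (∀ {i} → i < n → f i ≡ + 0) → ∑ n f ≡ + 0
  ∑-zero zero    f≡0 = refl
  ∑-zero (suc n) f≡0 = cong₂ _+_ (∑-zero n (f≡0 ∘ ℕ.m<n⇒m<1+n)) (f≡0 ℕ.≤-refl)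

  ∑-+ : ∀ n f g → ∑[ i < n ] (f i + g i) ≡ ∑ n f + ∑ n g
  ∑-+ zero    f g = refl
  ∑-+ (suc n) f g = trans (cong (_+ (f n + g n)) (∑-+ n f g)) (interchange (∑ n f) (∑ n g) (f n) (g n))
    where
    interchange : ∀ a b c d → (a + b) + (c + d) ≡ (a + c) + (b + d)
    interchange = solve-∀

  *-distribˡ-∑ : ∀ n c f → c * ∑ n f ≡ ∑[ i < n ] (c * f i)
  *-distribˡ-∑ zero    c f = *-zeroʳ c
  *-distribˡ-∑ (suc n) c f = trans (*-distribˡ-+ c (∑ n f) (f n)) (cong (_+ c * f n) (*-distribˡ-∑ n c f))

  *-distribʳ-∑ : ∀ n c f → ∑ n f * c ≡ ∑[ i < n ] (f i * c)
  *-distribʳ-∑ n c f =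
    trans (*-comm (∑ n f) c) (trans (*-distribˡ-∑ n c f) (∑-cong-≗ n (λ i → *-comm c (f i))))

  ∑-*-∑ : ∀ m n c f g → c * ∑ m f * ∑ n g ≡ ∑[ i < m ] ∑[ j < n ] (c * f i * g j)
  ∑-*-∑ m n c f g = begin
    c * ∑ m f * ∑ n g                     ≡⟨ cong (_* ∑ n g) (*-distribˡ-∑ m c f) ⟩
    ∑[ i < m ] (c * f i) * ∑ n g          ≡⟨ *-distribʳ-∑ m (∑ n g) _ ⟩
    ∑[ i < m ] (c * f i * ∑ n g)          ≡⟨ ∑-cong-≗ m (λ i → *-distribˡ-∑ n (c * f i) g) ⟩
    ∑[ i < m ] ∑[ j < n ] (c * f i * g j) ∎
    where open ≡-Reasoning

  ∑-split : ∀ m n f → ∑ (m ℕ.+ n) f ≡ ∑ m f + ∑[ i < n ] f (m ℕ.+ i)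
  ∑-split m zero    f = trans (cong (λ k → ∑ k f) (ℕ.+-identityʳ m)) (sym (+-identityʳ (∑ m f)))
  ∑-split m (suc n) f = trans (cong (λ k → ∑ k f) (ℕ.+-suc m n))
    (trans (cong (_+ f (m ℕ.+ n)) (∑-split m n f)) (+-assoc (∑ m f) _ _))

  ∑-head : ∀ n f → ∑ (suc n) f ≡ f 0 + ∑[ i < n ] f (suc i)
  ∑-head n f = trans (∑-split 1 n f) (cong (_+ ∑[ i < n ] f (suc i)) (+-identityˡ (f 0)))

  ∑-swap : ∀ m n (f : ℕ → ℕ → ℤ) → ∑[ i < m ] ∑[ j < n ] f i j ≡ ∑[ j < n ] ∑[ i < m ] f i j
  ∑-swap zero    n f = sym (∑-zero n (λ _ → refl))
  ∑-swap (suc m) n f = trans (cong (_+ ∑ n (f m)) (∑-swap m n f)) (sym (∑-+ n _ (f m)))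

  ∑-truncate : ∀ {m n} f → m ≤ n → (∀ {i} → m ≤ i → f i ≡ + 0) → ∑ n f ≡ ∑ m f
  ∑-truncate {m} {n} f m≤n f≡0 = begin
    ∑ n f                               ≡⟨ cong (λ k → ∑ k f) (sym (ℕ.m+[n∸m]≡n m≤n)) ⟩
    ∑ (m ℕ.+ (n ∸ m)) f                 ≡⟨ ∑-split m (n ∸ m) f ⟩
    ∑ m f + ∑[ i < n ∸ m ] f (m ℕ.+ i)  ≡⟨ cong (λ x → ∑ m f + x) (∑-zero (n ∸ m) (λ {i} _ → f≡0 (ℕ.m≤m+n m i))) ⟩
    ∑ m f + + 0                         ≡⟨ +-identityʳ (∑ m f) ⟩
    ∑ m f                               ∎
    where open ≡-Reasoning

  ∑-drop : ∀ {p n} f → p ≤ n → (∀ {i} → i < p → f i ≡ + 0) → ∑ n f ≡ ∑[ e < n ∸ p ] f (p ℕ.+ e)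
  ∑-drop {p} {n} f p≤n f≡0 = begin
    ∑ n f                               ≡⟨ cong (λ k → ∑ k f) (sym (ℕ.m+[n∸m]≡n p≤n)) ⟩
    ∑ (p ℕ.+ (n ∸ p)) f                 ≡⟨ ∑-split p (n ∸ p) f ⟩
    ∑ p f + ∑[ e < n ∸ p ] f (p ℕ.+ e)  ≡⟨ cong (_+ ∑[ e < n ∸ p ] f (p ℕ.+ e)) (∑-zero p f≡0) ⟩
    + 0 + ∑[ e < n ∸ p ] f (p ℕ.+ e)    ≡⟨ +-identityˡ _ ⟩
    ∑[ e < n ∸ p ] f (p ℕ.+ e)          ∎
    where open ≡-Reasoning

  ∑-single : ∀ n k f → k < n → (∀ {i} → i < n → ¬ i ≡ k → f i ≡ + 0) → ∑ n f ≡ f k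
  ∑-single (suc n) k f k<1+n f≡0 with ℕ.m≤n⇒m<n∨m≡n (ℕ.≤-pred k<1+n)
  ... | inj₁ k<n = trans (cong₂ _+_ (∑-single n k f k<n (f≡0 ∘ ℕ.m<n⇒m<1+n))
                                    (f≡0 ℕ.≤-refl (λ n≡k → ℕ.<-irrefl (sym n≡k) k<n)))
                         (+-identityʳ (f k))
  ... | inj₂ refl = trans (cong (_+ f k) (∑-zero k (λ i<k → f≡0 (ℕ.m<n⇒m<1+n i<k) (λ i≡k → ℕ.<-irrefl i≡k i<k))))
                          (+-identityˡ (f k))

  ∑-triangle : ∀ N (H : ℕ → ℕ → ℤ) →
               (∀ u p → u < p → H u p ≡ + 0) → (∀ p e → N ≤ p ℕ.+ e → H (p ℕ.+ e) p ≡ + 0) →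
               ∑[ u < N ] ∑[ p < N ] H u p ≡ ∑[ p < N ] ∑[ e < N ] H (p ℕ.+ e) p
  ∑-triangle N H below above = trans (∑-swap N N H) (∑-cong N (λ {p} p<N → begin
    ∑[ u < N ] H u p              ≡⟨ ∑-drop (λ u → H u p) (ℕ.<⇒≤ p<N) (λ {u} → below u p) ⟩
    ∑[ e < N ∸ p ] H (p ℕ.+ e) p  ≡⟨ ∑-truncate (λ e → H (p ℕ.+ e) p) (ℕ.m∸n≤m N p)
                                                (λ {e} N∸p≤e → above p e (N≤p+e N∸p≤e)) ⟨
    ∑[ e < N ] H (p ℕ.+ e) p      ∎))
    where
    open ≡-Reasoning
    N≤p+e : ∀ {p e} → N ∸ p ≤ e → N ≤ p ℕ.+ e
    N≤p+e {p} N∸p≤e = ℕ.≤-trans (ℕ.m≤n+m∸n N p) (ℕ.+-monoʳ-≤ p N∸p≤e)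


module Stirling where

  open import Data.Nat using (ℕ; zero; suc; _<_; s≤s; _!)
  import Data.Nat.Properties as ℕ
  open import Data.Integer using (ℤ; +_; -_; _+_; _*_)
  open import Data.Integer.Properties
    using (+-identityˡ; +-identityʳ; *-zeroʳ; pos-*)
  open import Data.List using ([]; _∷_)
  open import Relation.Binary.PropositionalEquality
  open import Data.Integer.Tactic.RingSolver using (solve-∀)
  open import Defs

  coeff-+ₚ : ∀ p q b → coeff (p +ₚ q) b ≡ coeff p b + coeff q b
  coeff-+ₚ []      q       b       = sym (+-identityˡ _)
  coeff-+ₚ (x ∷ p) []      b       = sym (+-identityʳ _)
  coeff-+ₚ (x ∷ p) (y ∷ q) zero    = refl
  coeff-+ₚ (x ∷ p) (y ∷ q) (suc b) = coeff-+ₚ p q b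

  coeff-scaleₚ : ∀ c p b → coeff (scaleₚ c p) b ≡ c * coeff p b
  coeff-scaleₚ c []      b       = sym (*-zeroʳ c)
  coeff-scaleₚ c (x ∷ p) zero    = refl
  coeff-scaleₚ c (x ∷ p) (suc b) = coeff-scaleₚ c p b

  -- sPrev a b = s a (b − 1), read as 0 when b = 0.
  sPrev : ℕ → ℕ → ℤ
  sPrev a b = coeff (+ 0 ∷ fallingPoly a) b

  s-rec : ∀ a b → s (suc a) b ≡ sPrev a b + - (+ a) * s a b
  s-rec a b = trans (coeff-+ₚ (+ 0 ∷ fallingPoly a) (scaleₚ (- (+ a)) (fallingPoly a)) b)
                    (cong (λ x → sPrev a b + x) (coeff-scaleₚ (- (+ a)) (fallingPoly a) b))

  s-above-diagonal : ∀ {a b} → a < b → s a b ≡ + 0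
  s-above-diagonal {zero}  {suc b} _         = refl
  s-above-diagonal {suc a} {suc b} (s≤s a<b) = begin
    s (suc a) (suc b)                  ≡⟨ s-rec a (suc b) ⟩
    s a b + - (+ a) * s a (suc b)      ≡⟨ cong₂ (λ x y → x + - (+ a) * y)
                                            (s-above-diagonal a<b) (s-above-diagonal (ℕ.m<n⇒m<1+n a<b)) ⟩
    + 0 + - (+ a) * + 0                ≡⟨ +-identityˡ _ ⟩
    - (+ a) * + 0                      ≡⟨ *-zeroʳ (- (+ a)) ⟩
    + 0                                ∎
    where open ≡-Reasoning

  s-zero-column : ∀ a → s (suc a) 0 ≡ + 0
  s-zero-column zero    = refl
  s-zero-column (suc a) = begin
    s (suc (suc a)) 0                  ≡⟨ s-rec (suc a) 0 ⟩
    + 0 + - (+ suc a) * s (suc a) 0    ≡⟨ cong (λ x → + 0 + - (+ suc a) * x) (s-zero-column a) ⟩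
    + 0 + - (+ suc a) * + 0            ≡⟨ +-identityˡ _ ⟩
    - (+ suc a) * + 0                  ≡⟨ *-zeroʳ (- (+ suc a)) ⟩
    + 0                                ∎
    where open ≡-Reasoning

  s-first-column : ∀ a → s (suc a) 1 ≡ negOnePow a * + (a !)
  s-first-column zero    = refl
  s-first-column (suc a) = begin
    s (suc (suc a)) 1                              ≡⟨ s-rec (suc a) 1 ⟩
    s (suc a) 0 + - (+ suc a) * s (suc a) 1        ≡⟨ cong₂ (λ x y → x + - (+ suc a) * y)
                                                        (s-zero-column a) (s-first-column a) ⟩
    + 0 + - (+ suc a) * (negOnePow a * + (a !))    ≡⟨ +-identityˡ _ ⟩
    - (+ suc a) * (negOnePow a * + (a !))          ≡⟨ swap (+ suc a) (negOnePow a) (+ (a !)) ⟩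
    - negOnePow a * (+ suc a * + (a !))            ≡⟨ cong (- negOnePow a *_) (sym (pos-* (suc a) (a !))) ⟩
    - negOnePow a * + (suc a !)                    ∎
    where
    open ≡-Reasoning
    swap : ∀ x y z → - x * (y * z) ≡ - y * (x * z)
    swap = solve-∀


module Binomial where

  open import Data.Nat using (_+_; _*_; _∸_; _!; _≤_; _<_)
  open import Data.Nat.Properties
  open import Data.Nat.Combinatorics
    using (_C_; nCk≡n!/k![n-k]!; nCk≡nC[n∸k]; k>n⇒nCk≡0; k![n∸k]!∣n!)
  open import Data.Nat.DivMod using (_/_; m/n*n≡m)
  open import Relation.Binary.PropositionalEquality
  open import Relation.Nullary using (yes; no)
  open import Data.Nat.Tactic.RingSolver using (solve-∀)

  nCk*k!*[n∸k]!≡n! : ∀ {n k} → k ≤ n → (n C k) * (k ! * (n ∸ k) !) ≡ n !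
  nCk*k!*[n∸k]!≡n! {n} {k} k≤n =
    trans (cong (_* (k ! * (n ∸ k) !)) (nCk≡n!/k![n-k]! k≤n)) (m/n*n≡m (k![n∸k]!∣n! k≤n))
    where instance _ = m*n≢0 (k !) ((n ∸ k) !) {{k !≢0}} {{(n ∸ k) !≢0}}

  [m+n]Cm*m!*n!≡[m+n]! : ∀ m n → ((m + n) C m) * (m ! * n !) ≡ (m + n) !
  [m+n]Cm*m!*n!≡[m+n]! m n =
    trans (cong (λ k → ((m + n) C m) * (m ! * k !)) (sym (m+n∸m≡n m n)))
          (nCk*k!*[n∸k]!≡n! (m≤m+n m n))

  private
    trinomial : ∀ p j r → ((p + j + r) C (p + j)) * ((p + j) C p) ≡ ((p + (j + r)) C p) * ((j + r) C j)
    trinomial p j r = *-cancelʳ-≡ _ _ (p ! * (j ! * r !)) {{p!j!r!≢0}} (begin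
      ((p + j + r) C (p + j)) * ((p + j) C p) * (p ! * (j ! * r !))
        ≡⟨ regroupˡ ((p + j + r) C (p + j)) ((p + j) C p) (p !) (j !) (r !) ⟩
      ((p + j + r) C (p + j)) * (((p + j) C p) * (p ! * j !) * r !)
        ≡⟨ cong (λ x → ((p + j + r) C (p + j)) * (x * r !)) ([m+n]Cm*m!*n!≡[m+n]! p j) ⟩
      ((p + j + r) C (p + j)) * ((p + j) ! * r !)
        ≡⟨ [m+n]Cm*m!*n!≡[m+n]! (p + j) r ⟩
      (p + j + r) !
        ≡⟨ cong _! (+-assoc p j r) ⟩
      (p + (j + r)) !
        ≡⟨ [m+n]Cm*m!*n!≡[m+n]! p (j + r) ⟨
      ((p + (j + r)) C p) * (p ! * (j + r) !)
        ≡⟨ cong (λ x → ((p + (j + r)) C p) * (p ! * x)) ([m+n]Cm*m!*n!≡[m+n]! j r) ⟨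
      ((p + (j + r)) C p) * (p ! * (((j + r) C j) * (j ! * r !)))
        ≡⟨ regroupʳ ((p + (j + r)) C p) ((j + r) C j) (p !) (j !) (r !) ⟩
      ((p + (j + r)) C p) * ((j + r) C j) * (p ! * (j ! * r !)) ∎)
      where
      open ≡-Reasoning
      p!j!r!≢0 = m*n≢0 (p !) _ {{p !≢0}} {{m*n≢0 (j !) (r !) {{j !≢0}} {{r !≢0}}}}
      regroupˡ : ∀ a b x y z → a * b * (x * (y * z)) ≡ a * (b * (x * y) * z)
      regroupˡ = solve-∀
      regroupʳ : ∀ a b x y z → a * (x * (b * (y * z))) ≡ a * b * (x * (y * z))
      regroupʳ = solve-∀

  nC[p+j]*[p+j]Cp≡nCp*[n∸p]Cj : ∀ n p j → (n C (p + j)) * ((p + j) C p) ≡ (n C p) * ((n ∸ p) C j)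
  nC[p+j]*[p+j]Cp≡nCp*[n∸p]Cj n p j with p + j ≤? n
  ... | yes p+j≤n = begin
      (n C (p + j)) * ((p + j) C p)               ≡⟨ cong (λ m → (m C (p + j)) * ((p + j) C p)) n≡p+j+r ⟩
      ((p + j + r) C (p + j)) * ((p + j) C p)     ≡⟨ trinomial p j r ⟩
      ((p + (j + r)) C p) * ((j + r) C j)         ≡⟨ cong₂ (λ m m′ → (m C p) * (m′ C j)) (sym n≡p+[j+r])
                                                           (trans (sym (m+n∸m≡n p (j + r))) (cong (_∸ p) (sym n≡p+[j+r]))) ⟩
      (n C p) * ((n ∸ p) C j)                     ∎
    where
    open ≡-Reasoning
    r = n ∸ (p + j)
    n≡p+j+r : n ≡ p + j + r
    n≡p+j+r = sym (m+[n∸m]≡n p+j≤n)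
    n≡p+[j+r] : n ≡ p + (j + r)
    n≡p+[j+r] = trans n≡p+j+r (+-assoc p j r)
  ... | no p+j≰n with p ≤? n
  ...   | yes p≤n = trans (cong (_* ((p + j) C p)) (k>n⇒nCk≡0 (≰⇒> p+j≰n)))
                          (sym (trans (cong ((n C p) *_) (k>n⇒nCk≡0 n∸p<j)) (*-zeroʳ (n C p))))
    where
    n∸p<j : n ∸ p < j
    n∸p<j = +-cancelˡ-< p (n ∸ p) j (subst (_< p + j) (sym (m+[n∸m]≡n p≤n)) (≰⇒> p+j≰n))
  ...   | no p≰n = trans (cong (_* ((p + j) C p)) (k>n⇒nCk≡0 (<-≤-trans (≰⇒> p≰n) (m≤m+n p j))))
                         (sym (cong (_* ((n ∸ p) C j)) (k>n⇒nCk≡0 (≰⇒> p≰n))))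

  nCi*[n∸i]Cj≡nCj*[n∸j]Ci : ∀ n i j → (n C i) * ((n ∸ i) C j) ≡ (n C j) * ((n ∸ j) C i)
  nCi*[n∸i]Cj≡nCj*[n∸j]Ci n i j = begin
    (n C i) * ((n ∸ i) C j)            ≡⟨ nC[p+j]*[p+j]Cp≡nCp*[n∸p]Cj n i j ⟨
    (n C (i + j)) * ((i + j) C i)      ≡⟨ cong₂ (λ k m → (n C k) * m) (+-comm i j) [i+j]Ci≡[j+i]Cj ⟩
    (n C (j + i)) * ((j + i) C j)      ≡⟨ nC[p+j]*[p+j]Cp≡nCp*[n∸p]Cj n j i ⟩
    (n C j) * ((n ∸ j) C i)            ∎
    where
    open ≡-Reasoning
    [i+j]Ci≡[j+i]Cj : (i + j) C i ≡ (j + i) C j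
    [i+j]Ci≡[j+i]Cj = trans (nCk≡nC[n∸k] (m≤m+n i j))
                            (cong₂ _C_ (+-comm i j) (m+n∸m≡n i j))


module Indicator where

  open import Data.Bool using (true; false; if_then_else_; T)
  open import Data.Empty using (⊥-elim)
  open import Data.Integer using (ℤ; +_; _*_)
  open import Data.Integer.Properties using (*-zeroʳ)
  open import Relation.Binary.PropositionalEquality using (_≡_; refl)
  open import Relation.Nullary using (¬_)

  if-true : ∀ {A : Set} {b} {x y : A} → T b → (if b then x else y) ≡ x
  if-true {b = true} _ = refl

  if-false : ∀ {A : Set} {b} {x y : A} → ¬ T b → (if b then x else y) ≡ y
  if-false {b = true}  ¬T = ⊥-elim (¬T _)
  if-false {b = false} _  = refl

  if-cong : ∀ b {x y : ℤ} → (T b → x ≡ y) → (if b then x else + 0) ≡ (if b then y else + 0)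
  if-cong false _   = refl
  if-cong true  x≡y = x≡y _

  *-if : ∀ b c (x : ℤ) → c * (if b then x else + 0) ≡ (if b then c * x else + 0)
  *-if false c x = *-zeroʳ c
  *-if true  c x = refl


module StirlingMatrix where

  open import Data.Nat as ℕ using (ℕ; zero; suc; _<_; s≤s; _∸_; _≡ᵇ_; _≤ᵇ_; _≤?_)
  import Data.Nat.Properties as ℕ
  open import Data.Integer using (ℤ; +_; _+_; _*_)
  open import Data.Integer.Properties using (*-zeroʳ; *-identityʳ; *-identityˡ; *-assoc)
  open import Data.Bool using (if_then_else_)
  open import Relation.Binary.PropositionalEquality
  open import Relation.Nullary using (yes; no)
  open import Defs
  open FiniteSum
  open Stirling
  open Indicator

  Matrix : Set
  Matrix = ℕ → ℕ → ℤ

  infixl 7 _·_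
  _·_ : Matrix → Matrix → Matrix
  (A · B) n r = ∑[ m < suc n ] (A n m * B m r)

  LowerTriangular : Matrix → Set
  LowerTriangular A = ∀ {n m} → n < m → A n m ≡ + 0

  s^ : ℕ → Matrix
  s^ k n r = t n k r

  t-above-diagonal : ∀ k → LowerTriangular (s^ k)
  t-above-diagonal zero    {n} {r} n<r = if-false (λ n≡r → ℕ.<-irrefl (ℕ.≡ᵇ⇒≡ n r n≡r) n<r)
  t-above-diagonal (suc k) {n} {r} n<r = if-false (λ r≤n → ℕ.<⇒≱ n<r (ℕ.≤ᵇ⇒≤ r n r≤n))

  t-suc : ∀ k n r → t n (suc k) r ≡ (s · s^ k) n r
  t-suc k n r with r ≤? n
  ... | yes r≤n = begin
    (if r ≤ᵇ n then Σ[0…_] (n ∸ r) (λ q → G (r ℕ.+ q)) else + 0)  ≡⟨ if-true (ℕ.≤⇒≤ᵇ r≤n) ⟩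
    Σ[0…_] (n ∸ r) (λ q → G (r ℕ.+ q))                             ≡⟨ Σ[0…]≡∑ (n ∸ r) _ ⟩
    ∑[ q < suc (n ∸ r) ] G (r ℕ.+ q)                               ≡⟨ cong (λ m → ∑[ q < m ] G (r ℕ.+ q))
                                                                         (ℕ.+-∸-assoc 1 r≤n) ⟨
    ∑[ q < suc n ∸ r ] G (r ℕ.+ q)                                 ≡⟨ ∑-drop G (ℕ.m≤n⇒m≤1+n r≤n) G<r≡0 ⟨
    ∑ (suc n) G                                                    ∎
    where
    open ≡-Reasoning
    G = λ m → s n m * t m k r
    G<r≡0 : ∀ {m} → m < r → G m ≡ + 0
    G<r≡0 {m} m<r = trans (cong (s n m *_) (t-above-diagonal k m<r)) (*-zeroʳ (s n m))
  ... | no r≰n = trans (if-false (λ r≤n → r≰n (ℕ.≤ᵇ⇒≤ r n r≤n))) (sym (∑-zero (suc n) G≡0))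
    where
    G≡0 : ∀ {m} → m < suc n → s n m * t m k r ≡ + 0
    G≡0 {m} m<1+n =
      trans (cong (s n m *_) (t-above-diagonal k (ℕ.≤-<-trans (ℕ.≤-pred m<1+n) (ℕ.≰⇒> r≰n)))) (*-zeroʳ (s n m))

  infix 4 _≋_
  _≋_ : Matrix → Matrix → Set
  A ≋ B = ∀ n r → A n r ≡ B n r

  ·-congˡ : ∀ {A A′} B → A ≋ A′ → A · B ≋ A′ · B
  ·-congˡ B A≋A′ n r = ∑-cong-≗ (suc n) (λ m → cong (_* B m r) (A≋A′ n m))

  ·-congʳ : ∀ A {B B′} → B ≋ B′ → A · B ≋ A · B′
  ·-congʳ A B≋B′ n r = ∑-cong-≗ (suc n) (λ m → cong (A n m *_) (B≋B′ m r))

  ·-identityˡ : ∀ A → s^ 0 · A ≋ A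
  ·-identityˡ A n r = trans (∑-single (suc n) n _ (ℕ.n<1+n n) off-diagonal)
                            (trans (cong (_* A n r) (if-true (ℕ.≡⇒≡ᵇ n n refl))) (*-identityˡ (A n r)))
    where
    off-diagonal : ∀ {m} → m < suc n → m ≢ n → t n 0 m * A m r ≡ + 0
    off-diagonal {m} _ m≢n = cong (_* A m r) (if-false (λ n≡m → m≢n (sym (ℕ.≡ᵇ⇒≡ n m n≡m))))

  ·-identityʳ : ∀ {A} → LowerTriangular A → A · s^ 0 ≋ A
  ·-identityʳ {A} lower n r with r ≤? n
  ... | yes r≤n = trans (∑-single (suc n) r _ (s≤s r≤n) off-diagonal)
                        (trans (cong (A n r *_) (if-true (ℕ.≡⇒≡ᵇ r r refl))) (*-identityʳ (A n r)))
    where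
    off-diagonal : ∀ {m} → m < suc n → m ≢ r → A n m * t m 0 r ≡ + 0
    off-diagonal {m} _ m≢r =
      trans (cong (A n m *_) (if-false (λ m≡r → m≢r (ℕ.≡ᵇ⇒≡ m r m≡r)))) (*-zeroʳ (A n m))
  ... | no r≰n = trans (∑-zero (suc n) below) (sym (lower (ℕ.≰⇒> r≰n)))
    where
    below : ∀ {m} → m < suc n → A n m * t m 0 r ≡ + 0
    below {m} m<1+n =
      trans (cong (A n m *_) (t-above-diagonal 0 (ℕ.≤-<-trans (ℕ.≤-pred m<1+n) (ℕ.≰⇒> r≰n)))) (*-zeroʳ (A n m))

  ·-assoc : ∀ A {B} C → LowerTriangular B → A · (B · C) ≋ (A · B) · C
  ·-assoc A {B} C lower n r = begin
    ∑[ m < suc n ] (A n m * ∑[ v < suc m ] (B m v * C v r))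
      ≡⟨ ∑-cong (suc n) (λ {m} m<1+n → trans (*-distribˡ-∑ (suc m) (A n m) _)
                                             (sym (∑-truncate _ m<1+n vanish))) ⟩
    ∑[ m < suc n ] ∑[ v < suc n ] (A n m * (B m v * C v r))
      ≡⟨ ∑-swap (suc n) (suc n) _ ⟩
    ∑[ v < suc n ] ∑[ m < suc n ] (A n m * (B m v * C v r))
      ≡⟨ ∑-cong-≗ (suc n) (λ v → trans (∑-cong-≗ (suc n) (λ m → sym (*-assoc (A n m) (B m v) (C v r))))
                                       (sym (*-distribʳ-∑ (suc n) (C v r) _))) ⟩
    ∑[ v < suc n ] ((A · B) n v * C v r) ∎
    where
    open ≡-Reasoning
    vanish : ∀ {m v} → m < v → A n m * (B m v * C v r) ≡ + 0
    vanish {m} {v} m<v = trans (cong (λ x → A n m * (x * C v r)) (lower m<v)) (*-zeroʳ (A n m))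

  t-one : s^ 1 ≋ s
  t-one n r = trans (t-suc 0 n r) (·-identityʳ s-above-diagonal n r)

  t-corner : ∀ k → t 0 k 0 ≡ + 1
  t-corner zero    = refl
  t-corner (suc k) = trans (*-identityˡ (t 0 k 0)) (t-corner k)

  t-one-one : ∀ k → t 1 k 1 ≡ + 1
  t-one-one zero    = refl
  t-one-one (suc k) = trans (*-identityˡ (t 1 k 1)) (t-one-one k)

  t-suc-right : ∀ k → s^ (suc k) ≋ s^ k · s
  t-suc-right zero n r = trans (t-one n r) (sym (·-identityˡ s n r))
  t-suc-right (suc k) n r = begin
    t n (suc (suc k)) r      ≡⟨ t-suc (suc k) n r ⟩
    (s · s^ (suc k)) n r     ≡⟨ ·-congʳ s (t-suc-right k) n r ⟩
    (s · (s^ k · s)) n r     ≡⟨ ·-assoc s s (t-above-diagonal k) n r ⟩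
    ((s · s^ k) · s) n r     ≡⟨ ·-congˡ s (λ n′ r′ → sym (t-suc k n′ r′)) n r ⟩
    (s^ (suc k) · s) n r     ∎
    where open ≡-Reasoning


module Jabotinsky where

  open import Data.Nat as ℕ using (ℕ; zero; suc; _≤_; _<_; s≤s; _∸_)
  import Data.Nat.Properties as ℕ
  open import Data.Nat.Combinatorics using (_C_; nCn≡1; k>n⇒nCk≡0; nCk+nC[k+1]≡[n+1]C[k+1])
  open import Data.Integer using (ℤ; +_; -_; _+_; _*_)
  open import Data.Integer.Properties
    using (+-identityˡ; +-identityʳ; *-identityʳ; *-zeroʳ; *-assoc; *-distribˡ-+; *-distribʳ-+; pos-+)
  open import Relation.Binary.PropositionalEquality
  open import Relation.Nullary using (yes; no)
  open import Data.Integer.Tactic.RingSolver using (solve-∀)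
  open import Defs
  open FiniteSum
  open Stirling
  open Binomial
  open StirlingMatrix

  record IsJabotinsky (A : Matrix) : Set where
    field
      lower    : LowerTriangular A
      corner   : A 0 0 ≡ + 1
      column₀  : ∀ n → A (suc n) 0 ≡ + 0
      binomial : ∀ n q d → A (suc n) (suc (q ℕ.+ d)) * + ((q ℕ.+ d) C q)
                           ≡ ∑[ p < suc n ] (+ (n C p) * A (suc p) (suc q) * A (n ∸ p) d)

  IsJabotinsky-resp : ∀ {A B} → A ≋ B → IsJabotinsky A → IsJabotinsky B
  IsJabotinsky-resp {A} {B} A≋B J = record
    { lower    = λ {n} {m} n<m → trans (sym (A≋B n m)) (lower n<m)
    ; corner   = trans (sym (A≋B 0 0)) corner
    ; column₀  = λ n → trans (sym (A≋B (suc n) 0)) (column₀ n)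
    ; binomial = λ n q d → trans (cong (_* + ((q ℕ.+ d) C q)) (sym (A≋B (suc n) (suc (q ℕ.+ d)))))
        (trans (binomial n q d)
               (∑-cong-≗ (suc n) (λ p → cong₂ (λ x y → + (n C p) * x * y) (A≋B (suc p) (suc q)) (A≋B (n ∸ p) d))))
    }
    where open IsJabotinsky J

  ∑-pascal : ∀ n (F : ℕ → ℤ) → ∑[ p < suc (suc n) ] (+ (suc n C p) * F p)
                     ≡ ∑[ p < suc n ] (+ (n C p) * F (suc p)) + ∑[ p < suc n ] (+ (n C p) * F p)
  ∑-pascal n F = begin
    ∑[ p < suc (suc n) ] (+ (suc n C p) * F p)
      ≡⟨ ∑-head (suc n) (λ p → + (suc n C p) * F p) ⟩
    + (suc n C 0) * F 0 + ∑[ p < suc n ] (+ (suc n C suc p) * F (suc p))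
      ≡⟨ cong (λ x → + (n C 0) * F 0 + x) (∑-cong-≗ (suc n) pascal) ⟩
    + (n C 0) * F 0 + ∑[ p < suc n ] (+ (n C p) * F (suc p) + + (n C suc p) * F (suc p))
      ≡⟨ cong (λ x → + (n C 0) * F 0 + x) (∑-+ (suc n) _ _) ⟩
    + (n C 0) * F 0 + (X + ∑[ p < suc n ] (+ (n C suc p) * F (suc p)))
      ≡⟨ cong (λ x → + (n C 0) * F 0 + (X + x)) last-term-vanishes ⟩
    + (n C 0) * F 0 + (X + ∑[ p < n ] (+ (n C suc p) * F (suc p)))
      ≡⟨ exchange (+ (n C 0) * F 0) X _ ⟩
    X + (+ (n C 0) * F 0 + ∑[ p < n ] (+ (n C suc p) * F (suc p)))
      ≡⟨ cong (λ x → X + x) (∑-head n (λ p → + (n C p) * F p)) ⟨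
    X + ∑[ p < suc n ] (+ (n C p) * F p) ∎
    where
    open ≡-Reasoning
    X = ∑[ p < suc n ] (+ (n C p) * F (suc p))
    exchange : ∀ a b c → a + (b + c) ≡ b + (a + c)
    exchange = solve-∀
    pascal : ∀ p → + (suc n C suc p) * F (suc p) ≡ + (n C p) * F (suc p) + + (n C suc p) * F (suc p)
    pascal p = trans (cong (λ c → + c * F (suc p)) (sym (nCk+nC[k+1]≡[n+1]C[k+1] n p)))
                     (trans (cong (_* F (suc p)) (pos-+ (n C p) (n C suc p)))
                            (*-distribʳ-+ (F (suc p)) (+ (n C p)) (+ (n C suc p))))
    last-term-vanishes : ∑[ p < suc n ] (+ (n C suc p) * F (suc p)) ≡ ∑[ p < n ] (+ (n C suc p) * F (suc p))
    last-term-vanishes = ∑-truncate _ (ℕ.n≤1+n n) (λ {p} n≤p →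
      cong (λ c → + c * F (suc p)) (k>n⇒nCk≡0 (s≤s n≤p)))

  sConv : ℕ → ℕ → ℕ → ℤ
  sConv q d n = ∑[ p < suc n ] (+ (n C p) * s (suc p) q * s (n ∸ p) d)

  sConvPrev : ℕ → ℕ → ℕ → ℤ
  sConvPrev q d n = ∑[ p < suc n ] (+ (n C p) * s (suc p) q * sPrev (n ∸ p) d)

  sConv-zero : ∀ d n → sConv 0 d n ≡ + 0
  sConv-zero d n = ∑-zero (suc n) (λ {p} _ →
    trans (cong (λ x → + (n C p) * x * s (n ∸ p) d) (s-zero-column p)) (zeroᵐ (+ (n C p)) (s (n ∸ p) d)))
    where
    zeroᵐ : ∀ c x → c * + 0 * x ≡ + 0
    zeroᵐ = solve-∀

  sConvPrev-zero : ∀ q n → sConvPrev q 0 n ≡ + 0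
  sConvPrev-zero q n = ∑-zero (suc n) (λ {p} _ → *-zeroʳ (+ (n C p) * s (suc p) q))

  sConv-suc : ∀ n q d → sConv (suc q) d (suc n) ≡ sConv q d n + sConvPrev (suc q) d n + - (+ suc n) * sConv (suc q) d n
  sConv-suc n q d = begin
    sConv (suc q) d (suc n)
      ≡⟨ ∑-cong-≗ (suc (suc n)) (λ p → *-assoc (+ (suc n C p)) _ _) ⟩
    ∑[ p < suc (suc n) ] (+ (suc n C p) * F p)
      ≡⟨ ∑-pascal n F ⟩
    ∑[ p < suc n ] (+ (n C p) * F (suc p)) + ∑[ p < suc n ] (+ (n C p) * F p)
      ≡⟨ ∑-+ (suc n) _ _ ⟨
    ∑[ p < suc n ] (+ (n C p) * F (suc p) + + (n C p) * F p)
      ≡⟨ ∑-cong (suc n) (λ p<1+n → recurrence (ℕ.≤-pred p<1+n)) ⟩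
    ∑[ p < suc n ] (U p + V p + - (+ suc n) * W p)
      ≡⟨ ∑-+ (suc n) _ _ ⟩
    ∑[ p < suc n ] (U p + V p) + ∑[ p < suc n ] (- (+ suc n) * W p)
      ≡⟨ cong₂ _+_ (sym (∑-+ (suc n) U V)) (*-distribˡ-∑ (suc n) (- (+ suc n)) W) ⟨
    sConv q d n + sConvPrev (suc q) d n + - (+ suc n) * sConv (suc q) d n ∎
    where
    open ≡-Reasoning
    F = λ p → s (suc p) (suc q) * s (suc n ∸ p) d
    U = λ p → + (n C p) * s (suc p) q * s (n ∸ p) d
    V = λ p → + (n C p) * s (suc p) (suc q) * sPrev (n ∸ p) d
    W = λ p → + (n C p) * s (suc p) (suc q) * s (n ∸ p) d
    distribute : ∀ c x y z w P M → c * ((x + - P * y) * z + y * (w + - M * z))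
                                   ≡ c * x * z + c * y * w + - (P + M) * (c * y * z)
    distribute = solve-∀
    recurrence : ∀ {p} → p ≤ n → + (n C p) * F (suc p) + + (n C p) * F p ≡ U p + V p + - (+ suc n) * W p
    recurrence {p} p≤n = begin
      + (n C p) * F (suc p) + + (n C p) * F p
        ≡⟨ *-distribˡ-+ (+ (n C p)) _ _ ⟨
      + (n C p) * (s (suc (suc p)) (suc q) * s (n ∸ p) d + s (suc p) (suc q) * s (suc n ∸ p) d)
        ≡⟨ cong₂ (λ x y → + (n C p) * (x * s (n ∸ p) d + s (suc p) (suc q) * y))
                 (s-rec (suc p) (suc q))
                 (trans (cong (λ m → s m d) (ℕ.+-∸-assoc 1 p≤n)) (s-rec (n ∸ p) d)) ⟩
      + (n C p) * ((s (suc p) q + - (+ suc p) * s (suc p) (suc q)) * s (n ∸ p) d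
                   + s (suc p) (suc q) * (sPrev (n ∸ p) d + - (+ (n ∸ p)) * s (n ∸ p) d))
        ≡⟨ distribute (+ (n C p)) (s (suc p) q) (s (suc p) (suc q)) (s (n ∸ p) d) (sPrev (n ∸ p) d)
                      (+ suc p) (+ (n ∸ p)) ⟩
      U p + V p + - (+ suc p + + (n ∸ p)) * W p
        ≡⟨ cong (λ m → U p + V p + - m * W p)
                (trans (sym (pos-+ (suc p) (n ∸ p))) (cong (λ m → + suc m) (ℕ.m+[n∸m]≡n p≤n))) ⟩
      U p + V p + - (+ suc n) * W p ∎

  mutual
    s-binomial : ∀ n q d → s (suc n) (suc (q ℕ.+ d)) * + ((q ℕ.+ d) C q) ≡ sConv (suc q) d n
    s-binomial zero    zero    zero    = refl
    s-binomial zero    zero    (suc d) = refl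
    s-binomial zero    (suc q) d       = refl
    s-binomial (suc n) q       d       = begin
      s (suc (suc n)) (suc K) * c
        ≡⟨ cong (_* c) (s-rec (suc n) (suc K)) ⟩
      (s (suc n) K + - (+ suc n) * s (suc n) (suc K)) * c
        ≡⟨ expand (s (suc n) K) (s (suc n) (suc K)) c (+ suc n) ⟩
      s (suc n) K * c + - (+ suc n) * (s (suc n) (suc K) * c)
        ≡⟨ cong₂ (λ x y → x + - (+ suc n) * y) (s-binomial-pred n q d) (s-binomial n q d) ⟩
      sConv q d n + sConvPrev (suc q) d n + - (+ suc n) * sConv (suc q) d n
        ≡⟨ sConv-suc n q d ⟨
      sConv (suc q) d (suc n) ∎
      where
      open ≡-Reasoning
      K = q ℕ.+ d
      c = + (K C q)
      expand : ∀ a b c N → (a + - N * b) * c ≡ a * c + - N * (b * c)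
      expand = solve-∀

    s-binomial-pred : ∀ n q d → s (suc n) (q ℕ.+ d) * + ((q ℕ.+ d) C q) ≡ sConv q d n + sConvPrev (suc q) d n
    s-binomial-pred n zero zero = begin
      s (suc n) 0 * + 1                   ≡⟨ cong (_* + 1) (s-zero-column n) ⟩
      + 0                                 ≡⟨ cong₂ _+_ (sConv-zero 0 n) (sConvPrev-zero 1 n) ⟨
      sConv 0 0 n + sConvPrev 1 0 n       ∎
      where open ≡-Reasoning
    s-binomial-pred n zero (suc d) = begin
      s (suc n) (suc d) * + 1             ≡⟨ s-binomial n 0 d ⟩
      sConv 1 d n                         ≡⟨ +-identityˡ _ ⟨
      + 0 + sConv 1 d n                   ≡⟨ cong (_+ sConv 1 d n) (sConv-zero (suc d) n) ⟨
      sConv 0 (suc d) n + sConvPrev 1 (suc d) n ∎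
      where open ≡-Reasoning
    s-binomial-pred n (suc q) zero = begin
      s (suc n) (suc q ℕ.+ 0) * + ((suc q ℕ.+ 0) C suc q)
        ≡⟨ cong (λ m → s (suc n) m * + (m C suc q)) (ℕ.+-identityʳ (suc q)) ⟩
      s (suc n) (suc q) * + (suc q C suc q)
        ≡⟨ cong (λ c → s (suc n) (suc q) * + c) (trans (nCn≡1 (suc q)) (sym (nCn≡1 q))) ⟩
      s (suc n) (suc q) * + (q C q)
        ≡⟨ cong (λ m → s (suc n) (suc m) * + (m C q)) (ℕ.+-identityʳ q) ⟨
      s (suc n) (suc (q ℕ.+ 0)) * + ((q ℕ.+ 0) C q)
        ≡⟨ s-binomial n q 0 ⟩
      sConv (suc q) 0 n
        ≡⟨ +-identityʳ _ ⟨
      sConv (suc q) 0 n + + 0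
        ≡⟨ cong (λ x → sConv (suc q) 0 n + x) (sConvPrev-zero (suc (suc q)) n) ⟨
      sConv (suc q) 0 n + sConvPrev (suc (suc q)) 0 n ∎
      where open ≡-Reasoning
    s-binomial-pred n (suc q) (suc d) = begin
      s′ * + (suc K C suc q)
        ≡⟨ cong (λ c → s′ * + c) (nCk+nC[k+1]≡[n+1]C[k+1] K q) ⟨
      s′ * + ((K C q) ℕ.+ (K C suc q))
        ≡⟨ trans (cong (s′ *_) (pos-+ (K C q) _)) (*-distribˡ-+ s′ _ _) ⟩
      s′ * + (K C q) + s′ * + (K C suc q)
        ≡⟨ cong₂ _+_ (s-binomial n q (suc d))
                     (trans (cong (λ m → s (suc n) (suc m) * + (m C suc q)) (ℕ.+-suc q d)) (s-binomial n (suc q) d)) ⟩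
      sConv (suc q) (suc d) n + sConvPrev (suc (suc q)) (suc d) n ∎
      where
      open ≡-Reasoning
      K = q ℕ.+ suc d
      s′ = s (suc n) (suc K)

  s-isJabotinsky : IsJabotinsky s
  s-isJabotinsky = record
    { lower    = s-above-diagonal
    ; corner   = refl
    ; column₀  = s-zero-column
    ; binomial = s-binomial
    }

  ·-row : ∀ {A} → LowerTriangular A → ∀ B {w N} m → w < N → (A · B) w m ≡ ∑[ e < N ] (A w e * B e m)
  ·-row {A} lower B {w} m w<N = sym (∑-truncate _ w<N (λ w<e → cong (_* B _ m) (lower w<e)))

  ·-suc-row : ∀ {A} → IsJabotinsky A → ∀ B {w N} m → w < N
              → (A · B) (suc w) m ≡ ∑[ p < N ] (A (suc w) (suc p) * B (suc p) m)
  ·-suc-row {A} J B {w} {N} m w<N = begin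
    ∑[ v < suc (suc w) ] (A (suc w) v * B v m)
      ≡⟨ ∑-head (suc w) _ ⟩
    A (suc w) 0 * B 0 m + ∑[ p < suc w ] (A (suc w) (suc p) * B (suc p) m)
      ≡⟨ cong (λ x → x * B 0 m + ∑[ p < suc w ] (A (suc w) (suc p) * B (suc p) m)) (column₀ w) ⟩
    + 0 * B 0 m + ∑[ p < suc w ] (A (suc w) (suc p) * B (suc p) m)
      ≡⟨ +-identityˡ _ ⟩
    ∑[ p < suc w ] (A (suc w) (suc p) * B (suc p) m)
      ≡⟨ ∑-truncate _ w<N (λ w<p → cong (_* B _ m) (lower (s≤s w<p))) ⟨
    ∑[ p < N ] (A (suc w) (suc p) * B (suc p) m) ∎
    where
    open ≡-Reasoning
    open IsJabotinsky J

  module _ {A B} (JA : IsJabotinsky A) (JB : IsJabotinsky B) where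
    private
      module JA = IsJabotinsky JA
      module JB = IsJabotinsky JB

    ·-lower : LowerTriangular (A · B)
    ·-lower {n} {m} n<m = ∑-zero (suc n) (λ {u} u<1+n →
      trans (cong (A n u *_) (JB.lower (ℕ.≤-<-trans (ℕ.≤-pred u<1+n) n<m))) (*-zeroʳ (A n u)))

    ·-column₀ : ∀ n → (A · B) (suc n) 0 ≡ + 0
    ·-column₀ n = ∑-zero (suc (suc n)) λ
      { {zero}  _ → cong (_* B 0 0) (JA.column₀ n)
      ; {suc u} _ → trans (cong (A (suc n) (suc u) *_) (JB.column₀ u)) (*-zeroʳ (A (suc n) (suc u))) }

    private
      term : ℕ → ℕ → ℕ → ℕ → ℕ → ℕ → ℤ
      term n q d p e w = + (n C w) * A (suc w) (suc p) * A (n ∸ w) e * (B (suc p) (suc q) * B e d)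

      ·-binomial-inner : ∀ n q d p e →
        A (suc n) (suc (p ℕ.+ e)) * (+ ((p ℕ.+ e) C p) * B (suc p) (suc q) * B (p ℕ.+ e ∸ p) d)
        ≡ ∑[ w < suc n ] term n q d p e w
      ·-binomial-inner n q d p e = begin
        A′ * (c * B (suc p) (suc q) * B (p ℕ.+ e ∸ p) d)  ≡⟨ cong (λ m → A′ * (c * B (suc p) (suc q) * B m d))
                                                                  (ℕ.m+n∸m≡n p e) ⟩
        A′ * (c * B (suc p) (suc q) * B e d)              ≡⟨ regroup A′ c (B (suc p) (suc q)) (B e d) ⟩
        A′ * c * (B (suc p) (suc q) * B e d)              ≡⟨ cong (_* (B (suc p) (suc q) * B e d)) (JA.binomial n p e) ⟩
        ∑[ w < suc n ] (+ (n C w) * A (suc w) (suc p) * A (n ∸ w) e) * (B (suc p) (suc q) * B e d)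
                                                          ≡⟨ *-distribʳ-∑ (suc n) _ _ ⟩
        ∑[ w < suc n ] term n q d p e w                   ∎
        where
        open ≡-Reasoning
        A′ = A (suc n) (suc (p ℕ.+ e))
        c  = + ((p ℕ.+ e) C p)
        regroup : ∀ a c x y → a * (c * x * y) ≡ a * c * (x * y)
        regroup = solve-∀

      ·-binomial-lhs : ∀ n q d → (A · B) (suc n) (suc (q ℕ.+ d)) * + ((q ℕ.+ d) C q)
                                 ≡ ∑[ p < suc n ] ∑[ e < suc n ] ∑[ w < suc n ] term n q d p e w
      ·-binomial-lhs n q d = begin
        (A · B) (suc n) (suc K) * c
          ≡⟨ cong (_* c) (·-suc-row JA B (suc K) (ℕ.n<1+n n)) ⟩
        ∑[ u < suc n ] (A (suc n) (suc u) * B (suc u) (suc K)) * c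
          ≡⟨ *-distribʳ-∑ (suc n) c _ ⟩
        ∑[ u < suc n ] (A (suc n) (suc u) * B (suc u) (suc K) * c)
          ≡⟨ ∑-cong-≗ (suc n) (λ u → trans (*-assoc (A (suc n) (suc u)) _ _)
                                           (cong (A (suc n) (suc u) *_) (JB.binomial u q d))) ⟩
        ∑[ u < suc n ] (A (suc n) (suc u) * ∑[ p < suc u ] (+ (u C p) * B (suc p) (suc q) * B (u ∸ p) d))
          ≡⟨ ∑-cong (suc n) (λ {u} u<1+n → trans (*-distribˡ-∑ (suc u) (A (suc n) (suc u)) _)
                                                (sym (∑-truncate (H u) u<1+n (H-below u _)))) ⟩
        ∑[ u < suc n ] ∑[ p < suc n ] H u p
          ≡⟨ ∑-triangle (suc n) H H-below H-above ⟩
        ∑[ p < suc n ] ∑[ e < suc n ] H (p ℕ.+ e) p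
          ≡⟨ ∑-cong-≗ (suc n) (λ p → ∑-cong-≗ (suc n) (·-binomial-inner n q d p)) ⟩
        ∑[ p < suc n ] ∑[ e < suc n ] ∑[ w < suc n ] term n q d p e w ∎
        where
        open ≡-Reasoning
        K = q ℕ.+ d
        c = + (K C q)
        H : ℕ → ℕ → ℤ
        H u p = A (suc n) (suc u) * (+ (u C p) * B (suc p) (suc q) * B (u ∸ p) d)
        zeroᵐ : ∀ a x y → a * (+ 0 * x * y) ≡ + 0
        zeroᵐ = solve-∀
        H-below : ∀ u p → u < p → H u p ≡ + 0
        H-below u p u<p = trans (cong (λ x → A (suc n) (suc u) * (+ x * B (suc p) (suc q) * B (u ∸ p) d))
                                      (k>n⇒nCk≡0 u<p))
                                (zeroᵐ (A (suc n) (suc u)) (B (suc p) (suc q)) (B (u ∸ p) d))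
        H-above : ∀ p e → suc n ≤ p ℕ.+ e → H (p ℕ.+ e) p ≡ + 0
        H-above p e n<p+e = cong (_* (+ ((p ℕ.+ e) C p) * B (suc p) (suc q) * B (p ℕ.+ e ∸ p) d))
                                 (JA.lower (s≤s n<p+e))

      ·-binomial-rhs : ∀ n q d → ∑[ w < suc n ] (+ (n C w) * (A · B) (suc w) (suc q) * (A · B) (n ∸ w) d)
                                 ≡ ∑[ p < suc n ] ∑[ e < suc n ] ∑[ w < suc n ] term n q d p e w
      ·-binomial-rhs n q d = begin
        ∑[ w < suc n ] (+ (n C w) * (A · B) (suc w) (suc q) * (A · B) (n ∸ w) d)
          ≡⟨ ∑-cong (suc n) (λ {w} w<1+n → cong₂ (λ x y → + (n C w) * x * y)
                (·-suc-row JA B (suc q) w<1+n) (·-row JA.lower B d (s≤s (ℕ.m∸n≤m n w)))) ⟩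
        ∑[ w < suc n ] (+ (n C w) * ∑[ p < suc n ] (A (suc w) (suc p) * B (suc p) (suc q))
                                  * ∑[ e < suc n ] (A (n ∸ w) e * B e d))
          ≡⟨ ∑-cong-≗ (suc n) (λ w → ∑-*-∑ (suc n) (suc n) (+ (n C w)) _ _) ⟩
        ∑[ w < suc n ] ∑[ p < suc n ] ∑[ e < suc n ]
          (+ (n C w) * (A (suc w) (suc p) * B (suc p) (suc q)) * (A (n ∸ w) e * B e d))
          ≡⟨ ∑-cong-≗ (suc n) (λ w → ∑-cong-≗ (suc n) (λ p → ∑-cong-≗ (suc n) (λ e →
               regroup (+ (n C w)) (A (suc w) (suc p)) (B (suc p) (suc q)) (A (n ∸ w) e) (B e d)))) ⟩
        ∑[ w < suc n ] ∑[ p < suc n ] ∑[ e < suc n ] term n q d p e w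
          ≡⟨ ∑-swap (suc n) (suc n) _ ⟩
        ∑[ p < suc n ] ∑[ w < suc n ] ∑[ e < suc n ] term n q d p e w
          ≡⟨ ∑-cong-≗ (suc n) (λ p → ∑-swap (suc n) (suc n) _) ⟩
        ∑[ p < suc n ] ∑[ e < suc n ] ∑[ w < suc n ] term n q d p e w ∎
        where
        open ≡-Reasoning
        regroup : ∀ c a₁ b₁ a₂ b₂ → c * (a₁ * b₁) * (a₂ * b₂) ≡ c * a₁ * a₂ * (b₁ * b₂)
        regroup = solve-∀

    ·-isJabotinsky : IsJabotinsky (A · B)
    ·-isJabotinsky = record
      { lower    = ·-lower
      ; corner   = trans (+-identityˡ _) (cong₂ _*_ JA.corner JB.corner)
      ; column₀  = ·-column₀
      ; binomial = λ n q d → trans (·-binomial-lhs n q d) (sym (·-binomial-rhs n q d))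
      }

  t-isJabotinsky : ∀ k → IsJabotinsky (s^ (suc k))
  t-isJabotinsky zero    = IsJabotinsky-resp (λ n r → sym (t-one n r)) s-isJabotinsky
  t-isJabotinsky (suc k) =
    IsJabotinsky-resp (λ n r → sym (t-suc (suc k) n r)) (·-isJabotinsky s-isJabotinsky (t-isJabotinsky k))

  t-binomial-recurrence : ∀ k r n → 1 ≤ k → 1 ≤ r → r ≤ n →
    t n k r ≡ Σ[0…_] (n ∸ r) (λ p → (+ ((n ∸ 1) C p)) * t (suc p) k 1 * t (n ∸ p ∸ 1) k (r ∸ 1))
  t-binomial-recurrence (suc k) (suc d) (suc n) _ _ (s≤s d≤n) = begin
    t (suc n) (suc k) (suc d)
      ≡⟨ *-identityʳ _ ⟨
    t (suc n) (suc k) (suc (0 ℕ.+ d)) * + ((0 ℕ.+ d) C 0)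
      ≡⟨ IsJabotinsky.binomial (t-isJabotinsky k) n 0 d ⟩
    ∑[ p < suc n ] T p
      ≡⟨ ∑-truncate T (s≤s (ℕ.m∸n≤m n d)) T-vanishes ⟩
    ∑[ p < suc (n ∸ d) ] T p
      ≡⟨ ∑-cong-≗ (suc (n ∸ d)) (λ p → cong (λ m → + (n C p) * t (suc p) (suc k) 1 * t m (suc k) d)
                                           (suc-n∸p∸1 p)) ⟨
    ∑[ p < suc (n ∸ d) ] (+ (n C p) * t (suc p) (suc k) 1 * t (suc n ∸ p ∸ 1) (suc k) d)
      ≡⟨ Σ[0…]≡∑ (n ∸ d) _ ⟨
    Σ[0…_] (suc n ∸ suc d)
      (λ p → (+ ((suc n ∸ 1) C p)) * t (suc p) (suc k) 1 * t (suc n ∸ p ∸ 1) (suc k) (suc d ∸ 1)) ∎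
    where
    open ≡-Reasoning
    suc-n∸p∸1 : ∀ p → suc n ∸ p ∸ 1 ≡ n ∸ p
    suc-n∸p∸1 p = trans (ℕ.∸-+-assoc (suc n) p 1) (cong (suc n ∸_) (ℕ.+-comm p 1))
    T = λ p → + (n C p) * t (suc p) (suc k) 1 * t (n ∸ p) (suc k) d
    T-vanishes : ∀ {p} → suc (n ∸ d) ≤ p → T p ≡ + 0
    T-vanishes {p} n∸d<p with p ℕ.≤? n
    ... | yes p≤n = trans (cong (+ (n C p) * t (suc p) (suc k) 1 *_) (t-above-diagonal (suc k) n∸p<d))
                          (*-zeroʳ (+ (n C p) * t (suc p) (suc k) 1))
      where
      n∸p<d : n ∸ p < d
      n∸p<d = subst (n ∸ p <_) (ℕ.m∸[m∸n]≡n d≤n) (ℕ.∸-monoʳ-< n∸d<p p≤n)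
    ... | no p≰n = cong (λ c → + c * t (suc p) (suc k) 1 * t (n ∸ p) (suc k) d) (k>n⇒nCk≡0 (ℕ.≰⇒> p≰n))


module Bell where

  open import Data.Nat as ℕ using (ℕ; zero; suc; _≤_; _<_; s≤s; z≤n; _∸_)
  import Data.Nat.Properties as ℕ
  open import Data.Nat.Induction using (<-rec)
  open import Data.Nat.Combinatorics using (_C_; k>n⇒nCk≡0)
  open import Data.Integer using (ℤ; +_; _+_; _*_)
  open import Data.Integer.Properties using (+-identityˡ; +-identityʳ; *-identityˡ; *-identityʳ; *-zeroʳ; pos-*)
  open import Relation.Binary.PropositionalEquality
  open import Data.Integer.Tactic.RingSolver using (solve-∀)
  open FiniteSum
  open StirlingMatrix
  open Jabotinsky
  open Binomial

  -- A n m is the partial Bell polynomial B_{n,m}(a 1, a 2, …).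
  record IsBellMatrix (a : ℕ → ℤ) (A : Matrix) : Set where
    field
      corner     : A 0 0 ≡ + 1
      row₀       : ∀ m → A 0 (suc m) ≡ + 0
      column₀    : ∀ n → A (suc n) 0 ≡ + 0
      recurrence : ∀ n d → A (suc n) (suc d) ≡ ∑[ p < suc n ] (+ (n C p) * a (suc p) * A (n ∸ p) d)

  IsBellMatrix-resp : ∀ {a b A B} → a ≗ b → A ≋ B → IsBellMatrix a A → IsBellMatrix b B
  IsBellMatrix-resp {a} {b} {A} {B} a≗b A≋B isBell = record
    { corner     = trans (sym (A≋B 0 0)) corner
    ; row₀       = λ m → trans (sym (A≋B 0 (suc m))) (row₀ m)
    ; column₀    = λ n → trans (sym (A≋B (suc n) 0)) (column₀ n)
    ; recurrence = λ n d → trans (sym (A≋B (suc n) (suc d))) (trans (recurrence n d)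
        (∑-cong-≗ (suc n) (λ p → cong₂ (λ x y → + (n C p) * x * y) (a≗b (suc p)) (A≋B (n ∸ p) d))))
    }
    where open IsBellMatrix isBell

  Jabotinsky⇒Bell : ∀ {A} → IsJabotinsky A → IsBellMatrix (λ j → A j 1) A
  Jabotinsky⇒Bell {A} J = record
    { corner     = corner
    ; row₀       = λ m → lower (s≤s z≤n)
    ; column₀    = column₀
    ; recurrence = λ n d → trans (sym (*-identityʳ _)) (binomial n 0 d)
    }
    where open IsJabotinsky J

  Bell-unique : ∀ {a b A B} → IsBellMatrix a A → IsBellMatrix b B →
                ∀ N → (∀ {j} → j ≤ N → a j ≡ b j) → ∀ m → A N m ≡ B N m
  Bell-unique {a} {b} {A} {B} BA BB N a≡b m = <-rec RowsAgree rows N ℕ.≤-refl m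
    where
    module BA = IsBellMatrix BA
    module BB = IsBellMatrix BB
    RowsAgree : ℕ → Set
    RowsAgree n = n ≤ N → ∀ m → A n m ≡ B n m
    rows : ∀ n → (∀ {n′} → n′ < n → RowsAgree n′) → RowsAgree n
    rows zero    _   _   zero    = trans BA.corner (sym BB.corner)
    rows zero    _   _   (suc m) = trans (BA.row₀ m) (sym (BB.row₀ m))
    rows (suc n) _   _   zero    = trans (BA.column₀ n) (sym (BB.column₀ n))
    rows (suc n) rec n<N (suc d) = begin
      A (suc n) (suc d)                                   ≡⟨ BA.recurrence n d ⟩
      ∑[ p < suc n ] (+ (n C p) * a (suc p) * A (n ∸ p) d) ≡⟨ ∑-cong (suc n) agree ⟩
      ∑[ p < suc n ] (+ (n C p) * b (suc p) * B (n ∸ p) d) ≡⟨ BB.recurrence n d ⟨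
      B (suc n) (suc d)                                   ∎
      where
      open ≡-Reasoning
      agree : ∀ {p} → p < suc n → + (n C p) * a (suc p) * A (n ∸ p) d ≡ + (n C p) * b (suc p) * B (n ∸ p) d
      agree {p} p<1+n = cong₂ (λ x y → + (n C p) * x * y)
        (a≡b (ℕ.≤-trans p<1+n n<N))
        (rec (s≤s (ℕ.m∸n≤m n p)) (ℕ.≤-trans (ℕ.m∸n≤m n p) (ℕ.≤-trans (ℕ.n≤1+n n) n<N)) d)

  cauchy : Matrix → Matrix → ℕ → ℕ → ℕ → ℤ
  cauchy A B i j m = ∑[ u < suc m ] (A i u * B j (m ∸ u))

  -- The product of the bivariate generating functions ∑ A n m xⁿ/n! yᵐ and ∑ B n m xⁿ/n! yᵐ.
  _⊛_ : Matrix → Matrix → Matrix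
  (A ⊛ B) n m = ∑[ i < suc n ] (+ (n C i) * cauchy A B i (n ∸ i) m)

  module Convolution {a b A B} (BA : IsBellMatrix a A) (BB : IsBellMatrix b B) where
    private
      module BA = IsBellMatrix BA
      module BB = IsBellMatrix BB

      term : ℕ → (ℕ → ℤ) → ℕ → ℕ → ℕ → ℕ → ℤ
      term n c d p j u = + (n C p) * + ((n ∸ p) C j) * c (suc p) * A j u * B (n ∸ p ∸ j) (d ∸ u)

      tripleSum : ℕ → (ℕ → ℤ) → ℕ → ℤ
      tripleSum n c d = ∑[ p < suc n ] ∑[ j < suc n ] ∑[ u < suc d ] term n c d p j u

      expand-⊛ : ∀ n d c → ∑[ p < suc n ] (+ (n C p) * c (suc p) * (A ⊛ B) (n ∸ p) d) ≡ tripleSum n c d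
      expand-⊛ n d c = ∑-cong-≗ (suc n) λ p → begin
        + (n C p) * c (suc p) * ∑[ j < suc (n ∸ p) ] Z p j
          ≡⟨ cong (+ (n C p) * c (suc p) *_) (sym (∑-truncate (Z p) (s≤s (ℕ.m∸n≤m n p))
               (λ {j} n∸p<j → cong (_* cauchy A B j (n ∸ p ∸ j) d) (cong +_ (k>n⇒nCk≡0 n∸p<j))))) ⟩
        + (n C p) * c (suc p) * ∑[ j < suc n ] Z p j
          ≡⟨ *-distribˡ-∑ (suc n) (+ (n C p) * c (suc p)) (Z p) ⟩
        ∑[ j < suc n ] (+ (n C p) * c (suc p) * Z p j)
          ≡⟨ ∑-cong-≗ (suc n) (λ j →
               trans (cong (+ (n C p) * c (suc p) *_) (*-distribˡ-∑ (suc d) (+ ((n ∸ p) C j)) (W p j)))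
                     (trans (*-distribˡ-∑ (suc d) (+ (n C p) * c (suc p)) (λ u → + ((n ∸ p) C j) * W p j u))
                            (∑-cong-≗ (suc d) (λ u → regroup (+ (n C p)) (c (suc p)) (+ ((n ∸ p) C j))
                                                             (A j u) (B (n ∸ p ∸ j) (d ∸ u)))))) ⟩
        ∑[ j < suc n ] ∑[ u < suc d ] term n c d p j u ∎
        where
        open ≡-Reasoning
        W = λ p j u → A j u * B (n ∸ p ∸ j) (d ∸ u)
        Z = λ p j → + ((n ∸ p) C j) * cauchy A B j (n ∸ p ∸ j) d
        regroup : ∀ x c y P Q → x * c * (y * (P * Q)) ≡ x * y * c * P * Q
        regroup = solve-∀

      left-expansion : ∀ n d → ∑[ i < suc n ] (+ (n C i) * ∑[ u < suc d ] (A (suc i) (suc u) * B (n ∸ i) (d ∸ u)))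
                               ≡ tripleSum n a d
      left-expansion n d = begin
        ∑[ i < suc n ] (+ (n C i) * ∑[ u < suc d ] (A (suc i) (suc u) * B (n ∸ i) (d ∸ u)))
          ≡⟨ ∑-cong (suc n) (λ {i} i<1+n → cong (+ (n C i) *_) (∑-cong-≗ (suc d) (λ u →
               cong (_* B (n ∸ i) (d ∸ u)) (trans (BA.recurrence i u)
                 (sym (∑-truncate _ (s≤s (ℕ.≤-pred i<1+n)) (C-vanishes u))))))) ⟩
        ∑[ i < suc n ] (+ (n C i) * ∑[ u < suc d ] (∑[ p < suc n ] (+ (i C p) * a (suc p) * A (i ∸ p) u)
                                                    * B (n ∸ i) (d ∸ u)))
          ≡⟨ ∑-cong-≗ (suc n) (λ i →
               trans (cong (+ (n C i) *_) (∑-cong-≗ (suc d) (λ u → *-distribʳ-∑ (suc n) (B (n ∸ i) (d ∸ u)) _)))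
                     (trans (*-distribˡ-∑ (suc d) (+ (n C i)) _)
                            (∑-cong-≗ (suc d) (λ u → *-distribˡ-∑ (suc n) (+ (n C i)) _)))) ⟩
        ∑[ i < suc n ] ∑[ u < suc d ] ∑[ p < suc n ] H i u p
          ≡⟨ ∑-cong-≗ (suc n) (λ i → ∑-swap (suc d) (suc n) (H i)) ⟩
        ∑[ i < suc n ] ∑[ p < suc n ] ∑[ u < suc d ] H i u p
          ≡⟨ ∑-triangle (suc n) (λ i p → ∑[ u < suc d ] H i u p) below above ⟩
        ∑[ p < suc n ] ∑[ j < suc n ] ∑[ u < suc d ] H (p ℕ.+ j) u p
          ≡⟨ ∑-cong-≗ (suc n) (λ p → ∑-cong-≗ (suc n) (λ j → ∑-cong-≗ (suc d) (λ u → H-diagonal p j u))) ⟩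
        tripleSum n a d ∎
        where
        open ≡-Reasoning
        C-vanishes : ∀ {i} u {p} → i < p → + (i C p) * a (suc p) * A (i ∸ p) u ≡ + 0
        C-vanishes {i} u {p} i<p = cong (λ c → + c * a (suc p) * A (i ∸ p) u) (k>n⇒nCk≡0 i<p)
        H : ℕ → ℕ → ℕ → ℤ
        H i u p = + (n C i) * (+ (i C p) * a (suc p) * A (i ∸ p) u * B (n ∸ i) (d ∸ u))
        below : ∀ i p → i < p → ∑[ u < suc d ] H i u p ≡ + 0
        below i p i<p = ∑-zero (suc d) (λ {u} _ →
          trans (cong (λ x → + (n C i) * (x * B (n ∸ i) (d ∸ u))) (C-vanishes u i<p)) (*-zeroʳ (+ (n C i))))
        above : ∀ p j → suc n ≤ p ℕ.+ j → ∑[ u < suc d ] H (p ℕ.+ j) u p ≡ + 0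
        above p j n<p+j = ∑-zero (suc d) (λ {u} _ →
          cong (λ c → + c * (+ ((p ℕ.+ j) C p) * a (suc p) * A (p ℕ.+ j ∸ p) u * B (n ∸ (p ℕ.+ j)) (d ∸ u)))
               (k>n⇒nCk≡0 n<p+j))
        regroup : ∀ x y c P Q → x * (y * c * P * Q) ≡ x * y * c * P * Q
        regroup = solve-∀
        H-diagonal : ∀ p j u → H (p ℕ.+ j) u p ≡ term n a d p j u
        H-diagonal p j u = begin
          + (n C (p ℕ.+ j)) * (+ ((p ℕ.+ j) C p) * a (suc p) * A (p ℕ.+ j ∸ p) u * B (n ∸ (p ℕ.+ j)) (d ∸ u))
            ≡⟨ cong₂ (λ x y → + (n C (p ℕ.+ j)) * (+ ((p ℕ.+ j) C p) * a (suc p) * A x u * B y (d ∸ u)))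
                     (ℕ.m+n∸m≡n p j) (sym (ℕ.∸-+-assoc n p j)) ⟩
          + (n C (p ℕ.+ j)) * (+ ((p ℕ.+ j) C p) * a (suc p) * A j u * B (n ∸ p ∸ j) (d ∸ u))
            ≡⟨ regroup (+ (n C (p ℕ.+ j))) (+ ((p ℕ.+ j) C p)) (a (suc p)) (A j u) (B (n ∸ p ∸ j) (d ∸ u)) ⟩
          + (n C (p ℕ.+ j)) * + ((p ℕ.+ j) C p) * a (suc p) * A j u * B (n ∸ p ∸ j) (d ∸ u)
            ≡⟨ cong (λ c → c * a (suc p) * A j u * B (n ∸ p ∸ j) (d ∸ u))
                    (trans (sym (pos-* (n C (p ℕ.+ j)) _))
                           (trans (cong +_ (nC[p+j]*[p+j]Cp≡nCp*[n∸p]Cj n p j)) (pos-* (n C p) _))) ⟩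
          term n a d p j u ∎

      right-expansion : ∀ n d → ∑[ i < suc n ] (+ (n C i) * ∑[ u < suc d ] (A i u * B (suc (n ∸ i)) (suc (d ∸ u))))
                                ≡ tripleSum n b d
      right-expansion n d = begin
        ∑[ i < suc n ] (+ (n C i) * ∑[ u < suc d ] (A i u * B (suc (n ∸ i)) (suc (d ∸ u))))
          ≡⟨ ∑-cong-≗ (suc n) (λ i → cong (+ (n C i) *_) (∑-cong-≗ (suc d) (λ u → cong (A i u *_)
               (trans (BB.recurrence (n ∸ i) (d ∸ u)) (sym (∑-truncate _ (s≤s (ℕ.m∸n≤m n i)) (C-vanishes i u))))))) ⟩
        ∑[ i < suc n ] (+ (n C i) * ∑[ u < suc d ] (A i u * ∑[ p < suc n ] (+ ((n ∸ i) C p) * b (suc p)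
                                                                            * B (n ∸ i ∸ p) (d ∸ u))))
          ≡⟨ ∑-cong-≗ (suc n) (λ i →
               trans (cong (+ (n C i) *_) (∑-cong-≗ (suc d) (λ u → *-distribˡ-∑ (suc n) (A i u) _)))
                     (trans (*-distribˡ-∑ (suc d) (+ (n C i)) _)
                            (∑-cong-≗ (suc d) (λ u → *-distribˡ-∑ (suc n) (+ (n C i)) _)))) ⟩
        ∑[ i < suc n ] ∑[ u < suc d ] ∑[ p < suc n ] H i u p
          ≡⟨ ∑-cong-≗ (suc n) (λ i → ∑-swap (suc d) (suc n) (H i)) ⟩
        ∑[ i < suc n ] ∑[ p < suc n ] ∑[ u < suc d ] H i u p
          ≡⟨ ∑-swap (suc n) (suc n) (λ i p → ∑[ u < suc d ] H i u p) ⟩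
        ∑[ p < suc n ] ∑[ i < suc n ] ∑[ u < suc d ] H i u p
          ≡⟨ ∑-cong-≗ (suc n) (λ p → ∑-cong-≗ (suc n) (λ i → ∑-cong-≗ (suc d) (λ u → H≡term i u p))) ⟩
        tripleSum n b d ∎
        where
        open ≡-Reasoning
        C-vanishes : ∀ i u {p} → suc (n ∸ i) ≤ p → + ((n ∸ i) C p) * b (suc p) * B (n ∸ i ∸ p) (d ∸ u) ≡ + 0
        C-vanishes i u {p} n∸i<p = cong (λ c → + c * b (suc p) * B (n ∸ i ∸ p) (d ∸ u)) (k>n⇒nCk≡0 n∸i<p)
        H : ℕ → ℕ → ℕ → ℤ
        H i u p = + (n C i) * (A i u * (+ ((n ∸ i) C p) * b (suc p) * B (n ∸ i ∸ p) (d ∸ u)))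
        regroup : ∀ x y c P Q → x * (P * (y * c * Q)) ≡ x * y * c * P * Q
        regroup = solve-∀
        H≡term : ∀ i u p → H i u p ≡ term n b d p i u
        H≡term i u p = begin
          + (n C i) * (A i u * (+ ((n ∸ i) C p) * b (suc p) * B (n ∸ i ∸ p) (d ∸ u)))
            ≡⟨ regroup (+ (n C i)) (+ ((n ∸ i) C p)) (b (suc p)) (A i u) (B (n ∸ i ∸ p) (d ∸ u)) ⟩
          + (n C i) * + ((n ∸ i) C p) * b (suc p) * A i u * B (n ∸ i ∸ p) (d ∸ u)
            ≡⟨ cong₂ (λ c m → c * b (suc p) * A i u * B m (d ∸ u))
                     (trans (sym (pos-* (n C i) _)) (trans (cong +_ (nCi*[n∸i]Cj≡nCj*[n∸j]Ci n i p)) (pos-* (n C p) _)))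
                     (trans (ℕ.∸-+-assoc n i p) (trans (cong (n ∸_) (ℕ.+-comm i p)) (sym (ℕ.∸-+-assoc n p i)))) ⟩
          term n b d p i u ∎

      cauchy-suc-left : ∀ i j d → cauchy A B (suc i) j (suc d) ≡ ∑[ u < suc d ] (A (suc i) (suc u) * B j (d ∸ u))
      cauchy-suc-left i j d = begin
        cauchy A B (suc i) j (suc d)                 ≡⟨ ∑-head (suc d) (λ u → A (suc i) u * B j (suc d ∸ u)) ⟩
        A (suc i) 0 * B j (suc d) + rest             ≡⟨ cong (λ x → x * B j (suc d) + rest) (BA.column₀ i) ⟩
        + 0 * B j (suc d) + rest                     ≡⟨ +-identityˡ rest ⟩
        rest                                         ∎
        where
        open ≡-Reasoning
        rest = ∑[ u < suc d ] (A (suc i) (suc u) * B j (d ∸ u))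

      cauchy-suc-right : ∀ i j d → cauchy A B i (suc j) (suc d) ≡ ∑[ u < suc d ] (A i u * B (suc j) (suc (d ∸ u)))
      cauchy-suc-right i j d = begin
        ∑[ u < suc d ] (A i u * B (suc j) (suc d ∸ u)) + A i (suc d) * B (suc j) (suc d ∸ suc d)
          ≡⟨ cong (λ x → ∑[ u < suc d ] (A i u * B (suc j) (suc d ∸ u)) + x) last-term-vanishes ⟩
        ∑[ u < suc d ] (A i u * B (suc j) (suc d ∸ u)) + + 0
          ≡⟨ +-identityʳ _ ⟩
        ∑[ u < suc d ] (A i u * B (suc j) (suc d ∸ u))
          ≡⟨ ∑-cong (suc d) (λ {u} u<1+d → cong (λ m → A i u * B (suc j) m) (ℕ.+-∸-assoc 1 (ℕ.≤-pred u<1+d))) ⟩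
        ∑[ u < suc d ] (A i u * B (suc j) (suc (d ∸ u))) ∎
        where
        open ≡-Reasoning
        last-term-vanishes : A i (suc d) * B (suc j) (suc d ∸ suc d) ≡ + 0
        last-term-vanishes = trans (cong (λ m → A i (suc d) * B (suc j) m) (ℕ.n∸n≡0 d))
                                   (trans (cong (A i (suc d) *_) (BB.column₀ j)) (*-zeroʳ (A i (suc d))))

    ⊛-recurrence : ∀ n d → (A ⊛ B) (suc n) (suc d)
                           ≡ ∑[ p < suc n ] (+ (n C p) * (a (suc p) + b (suc p)) * (A ⊛ B) (n ∸ p) d)
    ⊛-recurrence n d = begin
      (A ⊛ B) (suc n) (suc d)
        ≡⟨ ∑-pascal n (λ i → cauchy A B i (suc n ∸ i) (suc d)) ⟩
      ∑[ i < suc n ] (+ (n C i) * cauchy A B (suc i) (n ∸ i) (suc d))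
        + ∑[ i < suc n ] (+ (n C i) * cauchy A B i (suc n ∸ i) (suc d))
        ≡⟨ cong₂ _+_ (∑-cong-≗ (suc n) (λ i → cong (+ (n C i) *_) (cauchy-suc-left i (n ∸ i) d)))
                     (∑-cong (suc n) (λ {i} i<1+n → cong (+ (n C i) *_)
                       (trans (cong (λ j → cauchy A B i j (suc d)) (ℕ.+-∸-assoc 1 (ℕ.≤-pred i<1+n)))
                              (cauchy-suc-right i (n ∸ i) d)))) ⟩
      ∑[ i < suc n ] (+ (n C i) * ∑[ u < suc d ] (A (suc i) (suc u) * B (n ∸ i) (d ∸ u)))
        + ∑[ i < suc n ] (+ (n C i) * ∑[ u < suc d ] (A i u * B (suc (n ∸ i)) (suc (d ∸ u))))
        ≡⟨ cong₂ _+_ (left-expansion n d) (right-expansion n d) ⟩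
      tripleSum n a d + tripleSum n b d
        ≡⟨ cong₂ _+_ (expand-⊛ n d a) (expand-⊛ n d b) ⟨
      ∑[ p < suc n ] (+ (n C p) * a (suc p) * (A ⊛ B) (n ∸ p) d)
        + ∑[ p < suc n ] (+ (n C p) * b (suc p) * (A ⊛ B) (n ∸ p) d)
        ≡⟨ ∑-+ (suc n) _ _ ⟨
      ∑[ p < suc n ] (+ (n C p) * a (suc p) * (A ⊛ B) (n ∸ p) d + + (n C p) * b (suc p) * (A ⊛ B) (n ∸ p) d)
        ≡⟨ ∑-cong-≗ (suc n) (λ p → distrib (+ (n C p)) (a (suc p)) (b (suc p)) ((A ⊛ B) (n ∸ p) d)) ⟩
      ∑[ p < suc n ] (+ (n C p) * (a (suc p) + b (suc p)) * (A ⊛ B) (n ∸ p) d) ∎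
      where
      open ≡-Reasoning
      distrib : ∀ c x y z → c * x * z + c * y * z ≡ c * (x + y) * z
      distrib = solve-∀

    ⊛-isBellMatrix : IsBellMatrix (λ j → a j + b j) (A ⊛ B)
    ⊛-isBellMatrix = record
      { corner     = trans (+-identityˡ _) (trans (*-identityˡ _) (trans (+-identityˡ _)
                       (cong₂ _*_ BA.corner BB.corner)))
      ; row₀       = λ m → trans (+-identityˡ _) (trans (*-identityˡ _) (∑-zero (suc (suc m)) λ
          { {zero}  _ → trans (cong (A 0 0 *_) (BB.row₀ m)) (*-zeroʳ (A 0 0))
          ; {suc u} _ → cong (_* B 0 (suc m ∸ suc u)) (BA.row₀ u) }))
      ; column₀    = λ n → ∑-zero (suc (suc n)) λ
          { {zero}  _ → cong (+ 1 *_) (trans (+-identityˡ _)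
                          (trans (cong (A 0 0 *_) (BB.column₀ n)) (*-zeroʳ (A 0 0))))
          ; {suc i} _ → trans (cong (+ (suc n C suc i) *_) (trans (+-identityˡ _)
                                (cong (_* B (n ∸ i) 0) (BA.column₀ i))))
                              (*-zeroʳ (+ (suc n C suc i))) }
      ; recurrence = ⊛-recurrence
      }


module SinglePart where

  open import Data.Nat as ℕ using (ℕ; zero; suc; _≤_; _<_; s≤s; _∸_; _≡ᵇ_; _≤?_; _≟_)
  import Data.Nat.Properties as ℕ
  open import Data.Nat.Combinatorics using (_C_)
  open import Data.Integer using (ℤ; +_; _+_; _*_; _^_)
  open import Data.Integer.Properties using (*-zeroʳ; pos-*)
  open import Data.Bool using (if_then_else_)
  open import Relation.Binary.PropositionalEquality
  open import Relation.Nullary using (yes; no)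
  open import Data.Integer.Tactic.RingSolver using (solve-∀)
  open FiniteSum
  open Indicator
  open StirlingMatrix
  open Bell

  -- The number of ways to split a set of c (M + 1) elements into c blocks of size M + 1.
  blocks : ℕ → ℕ → ℕ
  blocks M zero    = 1
  blocks M (suc c) = ((M ℕ.+ c ℕ.* suc M) C M) ℕ.* blocks M c

  single : ℕ → ℤ → ℕ → ℤ
  single K x j = if j ≡ᵇ K then x else + 0

  singleBell : ℕ → ℤ → Matrix
  singleBell M x i u = if i ≡ᵇ u ℕ.* suc M then + blocks M u * x ^ u else + 0

  singleBell-isBellMatrix : ∀ M x → IsBellMatrix (single (suc M) x) (singleBell M x)
  singleBell-isBellMatrix M x =
    record { corner = refl ; row₀ = λ _ → refl ; column₀ = λ _ → refl ; recurrence = recurrence }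
    where
    K = suc M
    S = singleBell M x
    zeroᵐ : ∀ c y → c * + 0 * y ≡ + 0
    zeroᵐ = solve-∀
    off-M : ∀ n d p → p ≢ M → + (n C p) * single K x (suc p) * S (n ∸ p) d ≡ + 0
    off-M n d p p≢M = trans (cong (λ y → + (n C p) * y * S (n ∸ p) d) (if-false (λ p≡M → p≢M (ℕ.≡ᵇ⇒≡ p M p≡M))))
                              (zeroᵐ (+ (n C p)) (S (n ∸ p) d))
    recurrence : ∀ n d → S (suc n) (suc d) ≡ ∑[ p < suc n ] (+ (n C p) * single K x (suc p) * S (n ∸ p) d)
    recurrence n d with M ≤? n
    ... | no M≰n =
      trans (if-false (λ n≡M+dK → M≰n (subst (M ≤_) (sym (ℕ.≡ᵇ⇒≡ n _ n≡M+dK)) (ℕ.m≤m+n M (d ℕ.* K)))))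
            (sym (∑-zero (suc n) (λ {p} p<1+n → off-M n d p (λ { refl → M≰n (ℕ.≤-pred p<1+n) }))))
    ... | yes M≤n = sym (begin
      ∑[ p < suc n ] (+ (n C p) * single K x (suc p) * S (n ∸ p) d)
        ≡⟨ ∑-single (suc n) M _ (s≤s M≤n) (λ {p} _ → off-M n d p) ⟩
      + (n C M) * single K x K * S (n ∸ M) d
        ≡⟨ cong (λ y → + (n C M) * y * S (n ∸ M) d) (if-true (ℕ.≡⇒≡ᵇ M M refl)) ⟩
      + (n C M) * x * S (n ∸ M) d
        ≡⟨ at-M ⟩
      S (suc n) (suc d) ∎)
      where
      open ≡-Reasoning
      regroup : ∀ c y b z → c * y * (b * z) ≡ c * b * (y * z)
      regroup = solve-∀
      at-M : + (n C M) * x * S (n ∸ M) d ≡ S (suc n) (suc d)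
      at-M with n ≟ M ℕ.+ d ℕ.* K
      ... | yes n≡M+dK = begin
        + (n C M) * x * S (n ∸ M) d
          ≡⟨ cong (+ (n C M) * x *_) (if-true (ℕ.≡⇒≡ᵇ (n ∸ M) (d ℕ.* K) n∸M≡dK)) ⟩
        + (n C M) * x * (+ blocks M d * x ^ d)
          ≡⟨ regroup (+ (n C M)) x (+ blocks M d) (x ^ d) ⟩
        + (n C M) * + blocks M d * x ^ suc d
          ≡⟨ cong (_* x ^ suc d) (trans (sym (pos-* (n C M) (blocks M d)))
                                        (cong (λ m → + ((m C M) ℕ.* blocks M d)) n≡M+dK)) ⟩
        + blocks M (suc d) * x ^ suc d
          ≡⟨ if-true (ℕ.≡⇒≡ᵇ n (M ℕ.+ d ℕ.* K) n≡M+dK) ⟨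
        S (suc n) (suc d) ∎
        where
        n∸M≡dK : n ∸ M ≡ d ℕ.* K
        n∸M≡dK = trans (cong (_∸ M) n≡M+dK) (ℕ.m+n∸m≡n M (d ℕ.* K))
      ... | no n≢M+dK =
        trans (cong (+ (n C M) * x *_) (if-false (λ n∸M≡dK → n≢M+dK (n≡M+dK (ℕ.≡ᵇ⇒≡ (n ∸ M) _ n∸M≡dK)))))
              (trans (*-zeroʳ (+ (n C M) * x)) (sym (if-false (λ n≡M+dK → n≢M+dK (ℕ.≡ᵇ⇒≡ n _ n≡M+dK)))))
        where
        n≡M+dK : n ∸ M ≡ d ℕ.* K → n ≡ M ℕ.+ d ℕ.* K
        n≡M+dK n∸M≡dK = trans (sym (ℕ.m+[n∸m]≡n M≤n)) (cong (M ℕ.+_) n∸M≡dK)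


module PartitionSum where

  open import Data.Nat as ℕ using (ℕ; zero; suc; _≤_; _∸_; _≡ᵇ_; _≤ᵇ_; _≤?_)
  import Data.Nat.Properties as ℕ
  open import Data.Integer using (ℤ; +_; _+_; _*_)
  open import Data.Integer.Properties using (+-identityˡ)
  open import Data.Bool using (if_then_else_; T)
  open import Data.List using (List; []; _∷_; _++_; length; replicate)
  open import Data.Product using (Σ-syntax; _×_; _,_)
  open import Relation.Binary.PropositionalEquality
  open import Relation.Nullary using (yes; no)
  open import Relation.Nullary.Reflects using (fromEquivalence; T-reflects-elim)
  open FiniteSum
  open Indicator

  -- ∑part M N L h sums h over the nonincreasing lists of L parts from {1, …, M} with sum N.
  ∑part : ℕ → ℕ → ℕ → (List ℕ → ℤ) → ℤ
  ∑part M N zero    h = if 0 ≡ᵇ N then h [] else + 0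
  ∑part M N (suc L) h =
    ∑[ j < M ] (if suc j ≤ᵇ N then ∑part (suc j) (N ∸ suc j) L (λ xs → h (suc j ∷ xs)) else + 0)

  ∑partRun : ℕ → ℕ → ℕ → (List ℕ → ℤ) → ℕ → ℤ
  ∑partRun M N L h c =
    if c ℕ.* suc M ≤ᵇ N then ∑part M (N ∸ c ℕ.* suc M) (L ∸ c) (λ ys → h (replicate c (suc M) ++ ys)) else + 0

  -- The lists summed over by ∑part M N, written as runs of equal parts M, M − 1, …, 1.
  Partition≤ : ℕ → ℕ → List ℕ → Set
  Partition≤ zero    N xs = N ≡ 0 × xs ≡ []
  Partition≤ (suc M) N xs = Σ[ c ∈ ℕ ] Σ[ ys ∈ List ℕ ]
    xs ≡ replicate c (suc M) ++ ys × c ℕ.* suc M ≤ N × Partition≤ M (N ∸ c ℕ.* suc M) ys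

  ∑part-runs : ∀ M L N h → ∑part (suc M) N L h ≡ ∑[ c < suc L ] ∑partRun M N L h c
  ∑part-runs M zero    N h = sym (+-identityˡ _)
  ∑part-runs M (suc L) N h = begin
    ∑part M N (suc L) h + Part M                          ≡⟨ cong (λ x → ∑part M N (suc L) h + x) largest ⟩
    ∑partRun M N (suc L) h 0 + ∑[ c < suc L ] Run (suc c)  ≡⟨ ∑-head (suc L) Run ⟨
    ∑[ c < suc (suc L) ] Run c                             ∎
    where
    open ≡-Reasoning
    K = suc M
    Part = λ j → if suc j ≤ᵇ N then ∑part (suc j) (N ∸ suc j) L (λ xs → h (suc j ∷ xs)) else + 0
    Run = ∑partRun M N (suc L) h
    largest : Part M ≡ ∑[ c < suc L ] Run (suc c)
    largest with K ≤? N
    ... | yes K≤N = begin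
      Part M                                               ≡⟨ if-true (ℕ.≤⇒≤ᵇ K≤N) ⟩
      ∑part K (N ∸ K) L (λ xs → h (K ∷ xs))                ≡⟨ ∑part-runs M L (N ∸ K) (λ xs → h (K ∷ xs)) ⟩
      ∑[ c < suc L ] ∑partRun M (N ∸ K) L (λ xs → h (K ∷ xs)) c
        ≡⟨ ∑-cong-≗ (suc L) (λ c →
             cong₂ (λ b m → if b then ∑part M m (L ∸ c) (λ ys → h (K ∷ replicate c K ++ ys)) else + 0)
                   (T-reflects-elim (fromEquivalence (shift c) (unshift c)))
                   (ℕ.∸-+-assoc N K (c ℕ.* K))) ⟩
      ∑[ c < suc L ] Run (suc c)                           ∎
      where
      shift : ∀ c → T (c ℕ.* K ≤ᵇ N ∸ K) → T (K ℕ.+ c ℕ.* K ≤ᵇ N)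
      shift c cK≤N∸K =
        ℕ.≤⇒≤ᵇ (subst (K ℕ.+ c ℕ.* K ≤_) (ℕ.m+[n∸m]≡n K≤N) (ℕ.+-monoʳ-≤ K (ℕ.≤ᵇ⇒≤ _ _ cK≤N∸K)))
      unshift : ∀ c → T (K ℕ.+ c ℕ.* K ≤ᵇ N) → T (c ℕ.* K ≤ᵇ N ∸ K)
      unshift c K+cK≤N = ℕ.≤⇒≤ᵇ (ℕ.+-cancelˡ-≤ K (c ℕ.* K) (N ∸ K)
        (subst (K ℕ.+ c ℕ.* K ≤_) (sym (ℕ.m+[n∸m]≡n K≤N)) (ℕ.≤ᵇ⇒≤ _ _ K+cK≤N)))
    ... | no K≰N = trans (if-false (λ K≤N → K≰N (ℕ.≤ᵇ⇒≤ _ _ K≤N))) (sym (∑-zero (suc L) (λ {c} _ →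
      if-false (λ K+cK≤N → K≰N (ℕ.≤-trans (ℕ.m≤m+n K (c ℕ.* K)) (ℕ.≤ᵇ⇒≤ _ _ K+cK≤N))))))

  ∑part-cong : ∀ M N L {h h′} → (∀ xs → Partition≤ M N xs → h xs ≡ h′ xs) → ∑part M N L h ≡ ∑part M N L h′
  ∑part-cong zero    zero    zero    h≡h′ = h≡h′ [] (refl , refl)
  ∑part-cong zero    (suc N) zero    h≡h′ = refl
  ∑part-cong zero    N       (suc L) h≡h′ = refl
  ∑part-cong (suc M) N       L {h} {h′} h≡h′ = begin
    ∑part (suc M) N L h               ≡⟨ ∑part-runs M L N h ⟩
    ∑[ c < suc L ] ∑partRun M N L h c ≡⟨ ∑-cong-≗ (suc L) (λ c → if-cong (c ℕ.* suc M ≤ᵇ N) (λ cK≤N →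
                                          ∑part-cong M (N ∸ c ℕ.* suc M) (L ∸ c) (λ ys ys∈ →
                                            h≡h′ _ (c , ys , refl , ℕ.≤ᵇ⇒≤ _ _ cK≤N , ys∈)))) ⟩
    ∑[ c < suc L ] ∑partRun M N L h′ c ≡⟨ ∑part-runs M L N h′ ⟨
    ∑part (suc M) N L h′              ∎
    where open ≡-Reasoning

  ∑part-cong-length : ∀ M N L {h h′} → (∀ xs → length xs ≡ L → h xs ≡ h′ xs) → ∑part M N L h ≡ ∑part M N L h′
  ∑part-cong-length M N zero    h≡h′ = if-cong (0 ≡ᵇ N) (λ _ → h≡h′ [] refl)
  ∑part-cong-length M N (suc L) h≡h′ = ∑-cong-≗ M (λ j → if-cong (suc j ≤ᵇ N) (λ _ →
    ∑part-cong-length (suc j) (N ∸ suc j) L (λ xs ∣xs∣≡L → h≡h′ (suc j ∷ xs) (cong suc ∣xs∣≡L))))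

  *-distribˡ-∑part : ∀ M N L c h → c * ∑part M N L h ≡ ∑part M N L (λ xs → c * h xs)
  *-distribˡ-∑part M N zero    c h = *-if (0 ≡ᵇ N) c (h [])
  *-distribˡ-∑part M N (suc L) c h = trans (*-distribˡ-∑ M c _) (∑-cong-≗ M (λ j →
    trans (*-if (suc j ≤ᵇ N) c _)
          (if-cong (suc j ≤ᵇ N) (λ _ → *-distribˡ-∑part (suc j) (N ∸ suc j) L c (λ xs → h (suc j ∷ xs))))))


module PartitionEnumeration where

  open import Data.Nat as ℕ using (ℕ; zero; suc; _≤_; _<_; _∸_; _≡ᵇ_; _≤ᵇ_; _≤?_)
  import Data.Nat.Properties as ℕ
  open import Data.Nat.ListAction using () renaming (sum to sumℕ)
  open import Data.Integer using (ℤ; +_; _+_)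
  open import Data.Integer.Properties using (+-identityˡ; +-identityʳ; +-assoc)
  open import Data.Bool using (Bool; true; false; if_then_else_; T; _∧_)
  open import Data.Bool.Properties using (∧-assoc; ∧-zeroʳ; T-≡)
  open import Data.Empty using (⊥-elim)
  open import Data.List using (List; []; _∷_; _++_; map; concatMap; applyUpTo; filterᵇ)
  open import Data.List.Properties using (map-++; map-∘; map-cong)
  open import Function using (Equivalence)
  open import Relation.Binary.PropositionalEquality
  open import Relation.Nullary using (¬_; yes; no)
  open import Relation.Nullary.Reflects using (fromEquivalence; T-reflects-elim)
  open import Defs
  open FiniteSum
  open Indicator
  open PartitionSum

  sumℤ-++ : ∀ xs ys → sumℤ (xs ++ ys) ≡ sumℤ xs + sumℤ ys
  sumℤ-++ []       ys = sym (+-identityˡ _)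
  sumℤ-++ (x ∷ xs) ys = trans (cong (_+_ x) (sumℤ-++ xs ys)) (sym (+-assoc x (sumℤ xs) (sumℤ ys)))

  sumℤ-concatMap : ∀ {A B : Set} (g : B → ℤ) (F : A → List B) xs →
                   sumℤ (map g (concatMap F xs)) ≡ sumℤ (map (λ x → sumℤ (map g (F x))) xs)
  sumℤ-concatMap g F []       = refl
  sumℤ-concatMap g F (x ∷ xs) = trans (cong sumℤ (map-++ g (F x) (concatMap F xs)))
    (trans (sumℤ-++ (map g (F x)) _) (cong (_+_ (sumℤ (map g (F x)))) (sumℤ-concatMap g F xs)))

  sumℤ-applyUpTo : ∀ (g : ℕ → ℤ) (f : ℕ → ℕ) n →
                   sumℤ (map g (applyUpTo f n)) ≡ ∑[ i < n ] g (f i)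
  sumℤ-applyUpTo g f zero    = refl
  sumℤ-applyUpTo g f (suc n) = trans (cong (_+_ (g (f 0))) (sumℤ-applyUpTo g (λ i → f (suc i)) n))
                                     (sym (∑-head n (λ i → g (f i))))

  sumℤ-filterᵇ : ∀ {A : Set} (P : A → Bool) (h : A → ℤ) xs →
                 sumℤ (map h (filterᵇ P xs)) ≡ sumℤ (map (λ x → if P x then h x else + 0) xs)
  sumℤ-filterᵇ P h []       = refl
  sumℤ-filterᵇ P h (x ∷ xs) with P x
  ... | true  = cong (_+_ (h x)) (sumℤ-filterᵇ P h xs)
  ... | false = trans (sumℤ-filterᵇ P h xs) (sym (+-identityˡ _))

  sumℤ-zero : ∀ {A : Set} (f : A → ℤ) xs → (∀ x → f x ≡ + 0) → sumℤ (map f xs) ≡ + 0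
  sumℤ-zero f []       f≡0 = refl
  sumℤ-zero f (x ∷ xs) f≡0 = cong₂ _+_ (f≡0 x) (sumℤ-zero f xs f≡0)

  ∑lists : ℕ → ℕ → (List ℕ → Bool) → (List ℕ → ℤ) → ℤ
  ∑lists n L P h = sumℤ (map (λ xs → if P xs then h xs else + 0) (listsOf n L))

  ∑lists-suc : ∀ n L P h →
               ∑lists n (suc L) P h ≡ ∑[ j < n ] ∑lists n L (λ xs → P (suc j ∷ xs)) (λ xs → h (suc j ∷ xs))
  ∑lists-suc n L P h =
    trans (sumℤ-concatMap _ (λ j → map (suc j ∷_) (listsOf n L)) (applyUpTo (λ i → i) n))
          (trans (sumℤ-applyUpTo _ (λ i → i) n) (∑-cong-≗ n (λ j → cong sumℤ (sym (map-∘ (listsOf n L))))))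

  ∑lists-cong : ∀ n L {P Q} h → P ≗ Q → ∑lists n L P h ≡ ∑lists n L Q h
  ∑lists-cong n L h P≗Q =
    cong sumℤ (map-cong (λ xs → cong (λ b → if b then h xs else + 0) (P≗Q xs)) (listsOf n L))

  ∑lists-none : ∀ n L {P} h → (∀ xs → P xs ≡ false) → ∑lists n L P h ≡ + 0
  ∑lists-none n L h P≡false =
    sumℤ-zero _ (listsOf n L) (λ xs → cong (λ b → if b then h xs else + 0) (P≡false xs))

  headAtMost : ℕ → List ℕ → Bool
  headAtMost M []      = true
  headAtMost M (x ∷ _) = x ≤ᵇ M

  nonincreasing-∷ : ∀ x xs → nonincreasing (x ∷ xs) ≡ headAtMost x xs ∧ nonincreasing xs
  nonincreasing-∷ x []       = refl
  nonincreasing-∷ x (y ∷ ys) = refl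

  Fits : ℕ → ℕ → List ℕ → Bool
  Fits M N xs = (headAtMost M xs ∧ nonincreasing xs) ∧ (sumℕ xs ≡ᵇ N)

  FitsAfter : ℕ → ℕ → List ℕ → Bool
  FitsAfter j N xs = nonincreasing (suc j ∷ xs) ∧ (suc j ℕ.+ sumℕ xs ≡ᵇ N)

  Fits-∷ : ∀ M N j xs → Fits M N (suc j ∷ xs) ≡ (suc j ≤ᵇ M) ∧ FitsAfter j N xs
  Fits-∷ M N j xs = ∧-assoc (suc j ≤ᵇ M) _ _

  private
    T⇒≡true : ∀ {b} → T b → b ≡ true
    T⇒≡true = Equivalence.to T-≡

    ¬T⇒≡false : ∀ {b} → ¬ T b → b ≡ false
    ¬T⇒≡false ¬Tb = T-reflects-elim (fromEquivalence (λ Tb → ⊥-elim (¬Tb Tb)) (λ ()))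

    +-≡ᵇ-∸ : ∀ K x N → K ≤ N → (K ℕ.+ x ≡ᵇ N) ≡ (x ≡ᵇ N ∸ K)
    +-≡ᵇ-∸ K x N K≤N = T-reflects-elim (fromEquivalence
      (λ K+x≡N → ℕ.≡⇒≡ᵇ x (N ∸ K) (trans (sym (ℕ.m+n∸m≡n K x)) (cong (_∸ K) (ℕ.≡ᵇ⇒≡ _ _ K+x≡N))))
      (λ x≡N∸K → ℕ.≡⇒≡ᵇ (K ℕ.+ x) N (trans (cong (K ℕ.+_) (ℕ.≡ᵇ⇒≡ _ _ x≡N∸K)) (ℕ.m+[n∸m]≡n K≤N))))

    +-≡ᵇ-< : ∀ K x N → N < K → (K ℕ.+ x ≡ᵇ N) ≡ false
    +-≡ᵇ-< K x N N<K =
      ¬T⇒≡false (λ K+x≡N → ℕ.<⇒≱ N<K (subst (K ≤_) (ℕ.≡ᵇ⇒≡ _ N K+x≡N) (ℕ.m≤m+n K x)))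

  mutual
    ∑lists-Fits : ∀ {n} L M N h → M ≤ n → ∑lists n L (Fits M N) h ≡ ∑part M N L h
    ∑lists-Fits         zero    M N h _   = +-identityʳ _
    ∑lists-Fits {n} (suc L) M N h M≤n = begin
      ∑lists n (suc L) (Fits M N) h
        ≡⟨ ∑lists-suc n L (Fits M N) h ⟩
      ∑[ j < n ] ∑lists n L (λ xs → Fits M N (suc j ∷ xs)) (λ xs → h (suc j ∷ xs))
        ≡⟨ ∑-truncate _ M≤n (λ {j} M≤j → ∑lists-none n L _ (λ xs →
             trans (Fits-∷ M N j xs) (cong (_∧ FitsAfter j N xs) (¬T⇒≡false (λ j<M →
               ℕ.<-irrefl refl (ℕ.<-≤-trans (ℕ.≤ᵇ⇒≤ _ _ j<M) M≤j)))))) ⟩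
      ∑[ j < M ] ∑lists n L (λ xs → Fits M N (suc j ∷ xs)) (λ xs → h (suc j ∷ xs))
        ≡⟨ ∑-cong M (λ {j} j<M → trans
             (∑lists-cong n L _ (λ xs → trans (Fits-∷ M N j xs)
                                                (cong (_∧ FitsAfter j N xs) (T⇒≡true (ℕ.≤⇒≤ᵇ j<M)))))
             (∑lists-FitsAfter L j N _ (ℕ.≤-trans j<M M≤n))) ⟩
      ∑part M N (suc L) h ∎
      where open ≡-Reasoning

    ∑lists-FitsAfter : ∀ {n} L j N h → suc j ≤ n →
      ∑lists n L (FitsAfter j N) h ≡ (if suc j ≤ᵇ N then ∑part (suc j) (N ∸ suc j) L h else + 0)
    ∑lists-FitsAfter {n} L j N h j<n with suc j ≤? N
    ... | yes j<N = begin
      ∑lists n L (FitsAfter j N) h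
        ≡⟨ ∑lists-cong n L h (λ xs → cong₂ _∧_ (nonincreasing-∷ (suc j) xs) (+-≡ᵇ-∸ (suc j) (sumℕ xs) N j<N)) ⟩
      ∑lists n L (Fits (suc j) (N ∸ suc j)) h
        ≡⟨ ∑lists-Fits L (suc j) (N ∸ suc j) h j<n ⟩
      ∑part (suc j) (N ∸ suc j) L h
        ≡⟨ if-true (ℕ.≤⇒≤ᵇ j<N) ⟨
      (if suc j ≤ᵇ N then ∑part (suc j) (N ∸ suc j) L h else + 0) ∎
      where open ≡-Reasoning
    ... | no j≮N = trans
      (∑lists-none n L h (λ xs → trans (cong (nonincreasing (suc j ∷ xs) ∧_) (+-≡ᵇ-< (suc j) (sumℕ xs) N (ℕ.≰⇒> j≮N)))
                                       (∧-zeroʳ _)))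
      (sym (if-false (λ j<N → j≮N (ℕ.≤ᵇ⇒≤ _ _ j<N))))

  ∑lists-partitions : ∀ n L h → ∑lists n L (λ xs → nonincreasing xs ∧ (sumℕ xs ≡ᵇ n)) h ≡ ∑part n n L h
  ∑lists-partitions n zero    h = +-identityʳ _
  ∑lists-partitions n (suc L) h = trans (∑lists-suc n L _ h) (∑-cong n (λ {j} j<n → ∑lists-FitsAfter L j n _ j<n))

  sumℤ-partitions : ∀ n h → sumℤ (map h (partitions n)) ≡ ∑[ L < suc n ] ∑part n n L h
  sumℤ-partitions n h = begin
    sumℤ (map h (partitions n))
      ≡⟨ sumℤ-filterᵇ IsPartition h (concatMap (listsOf n) (applyUpTo (λ i → i) (suc n))) ⟩
    sumℤ (map guarded (concatMap (listsOf n) (applyUpTo (λ i → i) (suc n))))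
      ≡⟨ sumℤ-concatMap guarded (listsOf n) (applyUpTo (λ i → i) (suc n)) ⟩
    sumℤ (map (λ L → ∑lists n L IsPartition h) (applyUpTo (λ i → i) (suc n)))
      ≡⟨ sumℤ-applyUpTo _ (λ i → i) (suc n) ⟩
    ∑[ L < suc n ] ∑lists n L IsPartition h
      ≡⟨ ∑-cong-≗ (suc n) (λ L → ∑lists-partitions n L h) ⟩
    ∑[ L < suc n ] ∑part n n L h ∎
    where
    open ≡-Reasoning
    IsPartition : List ℕ → Bool
    IsPartition xs = nonincreasing xs ∧ (sumℕ xs ≡ᵇ n)
    guarded : List ℕ → ℤ
    guarded xs = if IsPartition xs then h xs else + 0


module PartitionWeight where

  open import Data.Nat
  open import Data.Nat.Properties
  open import Data.Nat.ListAction using () renaming (sum to sumℕ)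
  open import Data.Nat.Combinatorics using (_C_)
  open import Data.Nat.DivMod using (m*n/n≡m)
  open import Data.List using (List; []; _∷_; _++_; length; replicate; filterᵇ)
  open import Data.List.Properties using (filter-++; filter-all; filter-none; length-++; length-replicate)
  open import Data.List.Relation.Unary.All as All using (All; []; _∷_)
  open import Data.List.Relation.Unary.All.Properties using (++⁺; replicate⁺)
  open import Data.Product using (_×_; _,_; proj₁; proj₂)
  open import Relation.Binary.PropositionalEquality
  open import Relation.Nullary using (yes; no)
  open import Relation.Nullary.Decidable using (T?)
  open import Data.Nat.Tactic.RingSolver using (solve-∀)
  open import Defs using (mult; denom; denom≢0; f)
  open Binomial
  open SinglePart using (blocks)
  open PartitionSum using (Partition≤)

  mult-++ : ∀ xs ys j → mult (xs ++ ys) j ≡ mult xs j + mult ys j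
  mult-++ xs ys j =
    trans (cong length (filter-++ (λ x → T? (x ≡ᵇ j)) xs ys)) (length-++ (filterᵇ (_≡ᵇ j) xs))

  mult-replicate : ∀ c K → mult (replicate c K) K ≡ c
  mult-replicate c K =
    trans (cong length (filter-all (λ x → T? (x ≡ᵇ K)) (replicate⁺ c (≡⇒≡ᵇ K K refl)))) (length-replicate c)

  mult-replicate-≢ : ∀ c {K j} → K ≢ j → mult (replicate c K) j ≡ 0
  mult-replicate-≢ c {K} {j} K≢j =
    cong length (filter-none (λ x → T? (x ≡ᵇ j)) (replicate⁺ c (λ K≡j → K≢j (≡ᵇ⇒≡ K j K≡j))))

  mult-all-< : ∀ {xs j} → All (_< j) xs → mult xs j ≡ 0
  mult-all-< {xs} {j} all< =
    cong length (filter-none (λ x → T? (x ≡ᵇ j)) (All.map (λ x<j x≡j → <-irrefl (≡ᵇ⇒≡ _ j x≡j) x<j) all<))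

  Fac : List ℕ → ℕ → ℕ
  Fac xs j = (j !) ^ mult xs j * (mult xs j) !

  Fac-replicate-≢ : ∀ c {K j} ys → K ≢ j → Fac (replicate c K ++ ys) j ≡ Fac ys j
  Fac-replicate-≢ c {K} {j} ys K≢j = cong (λ m → (j !) ^ m * m !)
    (trans (mult-++ (replicate c K) ys j) (cong (_+ mult ys j) (mult-replicate-≢ c K≢j)))

  Fac-replicate-≡ : ∀ c K ys → mult ys K ≡ 0 → Fac (replicate c K ++ ys) K ≡ (K !) ^ c * c !
  Fac-replicate-≡ c K ys mult≡0 = cong (λ m → (K !) ^ m * m !)
    (trans (mult-++ (replicate c K) ys K) (trans (cong₂ _+_ (mult-replicate c K) mult≡0) (+-identityʳ c)))

  denom-replicate-< : ∀ c {K} J ys → J < K → denom J (replicate c K ++ ys) ≡ denom J ys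
  denom-replicate-< c zero    ys _   = refl
  denom-replicate-< c (suc J) ys J<K = cong₂ _*_ (denom-replicate-< c J ys (<-trans (n<1+n J) J<K))
                                                 (Fac-replicate-≢ c ys (λ K≡1+J → <-irrefl (sym K≡1+J) J<K))

  denom-replicate-≥ : ∀ c {K} J ys → .{{NonZero K}} → K ≤ J → mult ys K ≡ 0 →
                      denom J (replicate c K ++ ys) ≡ denom J ys * ((K !) ^ c * c !)
  denom-replicate-≥ c {suc _} zero ys ()
  denom-replicate-≥ c {K} (suc J) ys K≤1+J mult≡0 with K ≟ suc J
  ... | yes refl = begin
    denom J xs * Fac xs K    ≡⟨ cong₂ _*_ (denom-replicate-< c J ys (n<1+n J)) (Fac-replicate-≡ c K ys mult≡0) ⟩
    denom J ys * F           ≡⟨ cong (_* F) (*-identityʳ (denom J ys)) ⟨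
    denom J ys * 1 * F       ≡⟨ cong (λ m → denom J ys * ((K !) ^ m * m !) * F) mult≡0 ⟨
    denom J ys * Fac ys K * F ∎
    where
    open ≡-Reasoning
    xs = replicate c K ++ ys
    F  = (K !) ^ c * c !
  ... | no K≢1+J = begin
    denom J xs * Fac xs (suc J)       ≡⟨ cong₂ _*_ (denom-replicate-≥ c J ys K≤J mult≡0) (Fac-replicate-≢ c ys K≢1+J) ⟩
    denom J ys * F * Fac ys (suc J)   ≡⟨ exchange (denom J ys) F (Fac ys (suc J)) ⟩
    denom J ys * Fac ys (suc J) * F   ∎
    where
    open ≡-Reasoning
    xs  = replicate c K ++ ys
    F   = (K !) ^ c * c !
    K≤J = ≤-pred (≤∧≢⇒< K≤1+J K≢1+J)
    exchange : ∀ a b x → a * b * x ≡ a * x * b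
    exchange = solve-∀

  denom-replicate-++ : ∀ c M N ys → c * suc M ≤ N → All (_< suc M) ys →
                       denom N (replicate c (suc M) ++ ys) ≡ denom N ys * ((suc M !) ^ c * c !)
  denom-replicate-++ zero    M N ys _    _    = sym (*-identityʳ _)
  denom-replicate-++ (suc c) M N ys cK≤N ys<K =
    denom-replicate-≥ (suc c) N ys (≤-trans (m≤m+n (suc M) _) cK≤N) (mult-all-< ys<K)

  denom-all-≤ : ∀ {B J xs} → B ≤ J → All (_≤ B) xs → denom J xs ≡ denom B xs
  denom-all-≤ {B} {zero}  {xs} B≤J all≤ rewrite n≤0⇒n≡0 B≤J = refl
  denom-all-≤ {B} {suc J} {xs} B≤J all≤ with B ≟ suc J
  ... | yes refl = refl
  ... | no B≢1+J = begin
    denom J xs * Fac xs (suc J)  ≡⟨ cong₂ _*_ (denom-all-≤ (≤-pred B<1+J) all≤) (cong (λ m → (suc J !) ^ m * m !) mult≡0) ⟩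
    denom B xs * 1               ≡⟨ *-identityʳ _ ⟩
    denom B xs                   ∎
    where
    open ≡-Reasoning
    B<1+J = ≤∧≢⇒< B≤J B≢1+J
    mult≡0 = mult-all-< (All.map (λ x≤B → <-≤-trans (s≤s x≤B) B<1+J) all≤)

  sum-replicate-++ : ∀ c K ys → sumℕ (replicate c K ++ ys) ≡ c * K + sumℕ ys
  sum-replicate-++ zero    K ys = refl
  sum-replicate-++ (suc c) K ys =
    trans (cong (K +_) (sum-replicate-++ c K ys)) (sym (+-assoc K (c * K) (sumℕ ys)))

  parts≤sum : ∀ xs → All (_≤ sumℕ xs) xs
  parts≤sum []       = []
  parts≤sum (x ∷ xs) =
    m≤m+n x (sumℕ xs) ∷ All.map (λ y≤∑xs → ≤-trans y≤∑xs (m≤n+m (sumℕ xs) x)) (parts≤sum xs)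

  Partition≤⇒bounded : ∀ M N xs → Partition≤ M N xs → All (_≤ M) xs × sumℕ xs ≡ N
  Partition≤⇒bounded zero    N xs (refl , refl) = [] , refl
  Partition≤⇒bounded (suc M) N xs (c , ys , refl , cK≤N , ys∈)
    with ys≤M , ∑ys ← Partition≤⇒bounded M (N ∸ c * suc M) ys ys∈ =
      ++⁺ (replicate⁺ c ≤-refl) (All.map m≤n⇒m≤1+n ys≤M)
    , trans (sum-replicate-++ c (suc M) ys) (trans (cong (c * suc M +_) ∑ys) (m+[n∸m]≡n cK≤N))

  blocks*K!^c*c!≡[cK]! : ∀ M c → blocks M c * ((suc M !) ^ c * c !) ≡ (c * suc M) !
  blocks*K!^c*c!≡[cK]! M zero    = refl
  blocks*K!^c*c!≡[cK]! M (suc c) = begin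
    b * blocks M c * ((K !) ^ suc c * suc c !)
      ≡⟨ regroup b (blocks M c) (M !) ((K !) ^ c) (c !) M c ⟩
    (K * suc c) * (b * (M ! * (blocks M c * ((K !) ^ c * c !))))
      ≡⟨ cong₂ (λ x y → x * (b * (M ! * y))) (K*[1+c]≡1+M+cK M c) (blocks*K!^c*c!≡[cK]! M c) ⟩
    suc (M + c * K) * (b * (M ! * (c * K) !))
      ≡⟨ cong (suc (M + c * K) *_) ([m+n]Cm*m!*n!≡[m+n]! M (c * K)) ⟩
    suc (M + c * K) * (M + c * K) ! ∎
    where
    open ≡-Reasoning
    K = suc M
    b = (M + c * K) C M
    regroup : ∀ b x m p q M c → b * x * ((suc M * m) * p * (suc c * q))
                                ≡ (suc M * suc c) * (b * (m * (x * (p * q))))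
    regroup = solve-∀
    K*[1+c]≡1+M+cK : ∀ M c → suc M * suc c ≡ suc (M + c * suc M)
    K*[1+c]≡1+M+cK = solve-∀

  private
    f≡ : ∀ N xs q → N ! ≡ q * denom N xs → f N xs ≡ q
    f≡ N xs q N!≡q*D = trans (cong (λ m → (m / denom N xs) {{denom≢0 N xs}}) N!≡q*D)
                             (m*n/n≡m q (denom N xs) {{denom≢0 N xs}})

    N!-factorisation : ∀ M c N ys → c * suc M ≤ N → Partition≤ M (N ∸ c * suc M) ys →
      f (N ∸ c * suc M) ys * denom (N ∸ c * suc M) ys ≡ (N ∸ c * suc M) ! →
      N ! ≡ (N C (c * suc M)) * blocks M c * f (N ∸ c * suc M) ys * denom N (replicate c (suc M) ++ ys)
    N!-factorisation M c N ys cK≤N ys∈ f*D≡N′! = begin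
      N !                                                ≡⟨ nCk*k!*[n∸k]!≡n! cK≤N ⟨
      (N C cK) * (cK ! * N′ !)                           ≡⟨ cong₂ (λ x y → (N C cK) * (x * y))
                                                                  (blocks*K!^c*c!≡[cK]! M c) f*D≡N′! ⟨
      (N C cK) * (blocks M c * F * (f N′ ys * denom N′ ys))
                                                         ≡⟨ regroup (N C cK) (blocks M c) F (f N′ ys) (denom N′ ys) ⟩
      (N C cK) * blocks M c * f N′ ys * (denom N′ ys * F) ≡⟨ cong (λ D → (N C cK) * blocks M c * f N′ ys * D)
                                                                  denom-split ⟨
      (N C cK) * blocks M c * f N′ ys * denom N (replicate c K ++ ys) ∎
      where
      open ≡-Reasoning
      K  = suc M
      cK = c * K
      N′ = N ∸ cK
      F  = (K !) ^ c * c !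
      regroup : ∀ b x F fm D → b * (x * F * (fm * D)) ≡ b * x * fm * (D * F)
      regroup = solve-∀
      bounded = Partition≤⇒bounded M N′ ys ys∈
      denom-split : denom N (replicate c K ++ ys) ≡ denom N′ ys * F
      denom-split = trans (denom-replicate-++ c M N ys cK≤N (All.map s≤s (proj₁ bounded)))
        (cong (_* F) (denom-all-≤ (m∸n≤m N cK) (subst (λ B → All (_≤ B) ys) (proj₂ bounded) (parts≤sum ys))))

  f*denom≡! : ∀ M N xs → Partition≤ M N xs → f N xs * denom N xs ≡ N !
  f*denom≡! zero    N xs (refl , refl)                 = refl
  f*denom≡! (suc M) N ._ (c , ys , refl , cK≤N , ys∈) =
    trans (cong (_* denom N (replicate c (suc M) ++ ys)) (f≡ N _ q factorisation)) (sym factorisation)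
    where
    q = (N C (c * suc M)) * blocks M c * f (N ∸ c * suc M) ys
    factorisation = N!-factorisation M c N ys cK≤N ys∈ (f*denom≡! M _ ys ys∈)

  f-replicate-++ : ∀ M c N ys → c * suc M ≤ N → Partition≤ M (N ∸ c * suc M) ys →
                   f N (replicate c (suc M) ++ ys) ≡ (N C (c * suc M)) * blocks M c * f (N ∸ c * suc M) ys
  f-replicate-++ M c N ys cK≤N ys∈ =
    f≡ N _ _ (N!-factorisation M c N ys cK≤N ys∈ (f*denom≡! M _ ys ys∈))


module BellExpansion where

  open import Data.Nat as ℕ using (ℕ; zero; suc; _≤_; _<_; s≤s; _∸_; _≡ᵇ_; _≤ᵇ_; _≤?_; _≟_)
  import Data.Nat.Properties as ℕ
  open import Data.Nat.Combinatorics using (_C_)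
  open import Data.Integer using (ℤ; +_; _+_; _*_; _^_)
  open import Data.Integer.Properties using (+-identityˡ; +-identityʳ; *-identityˡ; *-assoc; pos-*)
  open import Data.Bool using (if_then_else_)
  open import Data.List using (List; _++_; map; replicate)
  open import Relation.Binary.PropositionalEquality
  open import Relation.Nullary using (yes; no)
  open import Relation.Nullary.Reflects using (fromEquivalence; T-reflects-elim)
  open import Data.Integer.Tactic.RingSolver using (solve-∀)
  open import Defs using (f; prodℤ)
  open FiniteSum
  open Indicator
  open StirlingMatrix using (Matrix; _≋_)
  open Bell
  open SinglePart
  open PartitionSum
  open PartitionWeight using (f-replicate-++)

  prodℤ-replicate-++ : ∀ (a : ℕ → ℤ) c K ys → prodℤ (map a (replicate c K ++ ys)) ≡ a K ^ c * prodℤ (map a ys)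
  prodℤ-replicate-++ a zero    K ys = sym (*-identityˡ _)
  prodℤ-replicate-++ a (suc c) K ys =
    trans (cong (a K *_) (prodℤ-replicate-++ a c K ys)) (sym (*-assoc (a K) (a K ^ c) _))

  module _ (a : ℕ → ℤ) where

    weight : ℕ → List ℕ → ℤ
    weight N xs = + f N xs * prodℤ (map a xs)

    bellSum : ℕ → Matrix
    bellSum M N L = ∑part M N L (weight N)

    truncate : ℕ → ℕ → ℤ
    truncate M j = if j ≤ᵇ M then a j else + 0

    weight-replicate-++ : ∀ M c N ys → c ℕ.* suc M ≤ N → Partition≤ M (N ∸ c ℕ.* suc M) ys →
      weight N (replicate c (suc M) ++ ys)
      ≡ + (N C (c ℕ.* suc M)) * + blocks M c * a (suc M) ^ c * weight (N ∸ c ℕ.* suc M) ys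
    weight-replicate-++ M c N ys cK≤N ys∈ = begin
      + f N (replicate c K ++ ys) * prodℤ (map a (replicate c K ++ ys))
        ≡⟨ cong₂ (λ x y → + x * y) (f-replicate-++ M c N ys cK≤N ys∈) (prodℤ-replicate-++ a c K ys) ⟩
      + (b ℕ.* blocks M c ℕ.* f N′ ys) * (a K ^ c * prodℤ (map a ys))
        ≡⟨ cong (_* (a K ^ c * prodℤ (map a ys)))
                (trans (pos-* (b ℕ.* blocks M c) (f N′ ys)) (cong (_* + f N′ ys) (pos-* b (blocks M c)))) ⟩
      + b * + blocks M c * + f N′ ys * (a K ^ c * prodℤ (map a ys))
        ≡⟨ regroup (+ b) (+ blocks M c) (+ f N′ ys) (a K ^ c) (prodℤ (map a ys)) ⟩
      + b * + blocks M c * a K ^ c * weight N′ ys ∎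
      where
      open ≡-Reasoning
      K  = suc M
      N′ = N ∸ c ℕ.* K
      b  = N C (c ℕ.* K)
      regroup : ∀ b x φ p q → b * x * φ * (p * q) ≡ b * x * p * (φ * q)
      regroup = solve-∀

    bellSum-suc : ∀ M → bellSum (suc M) ≋ singleBell M (a (suc M)) ⊛ bellSum M
    bellSum-suc M N L = begin
      ∑part (suc M) N L (weight N)
        ≡⟨ ∑part-runs M L N (weight N) ⟩
      ∑[ c < suc L ] ∑partRun M N L (weight N) c
        ≡⟨ ∑-cong-≗ (suc L) (λ c → if-cong (c ℕ.* K ≤ᵇ N) (λ cK≤N → trans
             (∑part-cong M (N ∸ c ℕ.* K) (L ∸ c) (λ ys → weight-replicate-++ M c N ys (ℕ.≤ᵇ⇒≤ _ _ cK≤N)))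
             (sym (*-distribˡ-∑part M (N ∸ c ℕ.* K) (L ∸ c) (coefficient c) (weight (N ∸ c ℕ.* K)))))) ⟩
      ∑[ c < suc L ] (if c ℕ.* K ≤ᵇ N then coefficient c * bellSum M (N ∸ c ℕ.* K) (L ∸ c) else + 0)
        ≡⟨ ∑-cong-≗ (suc L) (λ u → sym (column u)) ⟩
      ∑[ u < suc L ] ∑[ i < suc N ] (+ (N C i) * (S i u * bellSum M (N ∸ i) (L ∸ u)))
        ≡⟨ ∑-swap (suc L) (suc N) _ ⟩
      ∑[ i < suc N ] ∑[ u < suc L ] (+ (N C i) * (S i u * bellSum M (N ∸ i) (L ∸ u)))
        ≡⟨ ∑-cong-≗ (suc N) (λ i → sym (*-distribˡ-∑ (suc L) (+ (N C i)) _)) ⟩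
      (S ⊛ bellSum M) N L ∎
      where
      open ≡-Reasoning
      K = suc M
      x = a K
      S = singleBell M x
      coefficient : ℕ → ℤ
      coefficient c = + (N C (c ℕ.* K)) * + blocks M c * x ^ c
      zeroᵐ : ∀ c y → c * (+ 0 * y) ≡ + 0
      zeroᵐ = solve-∀
      regroup : ∀ c b p w → c * (b * p * w) ≡ c * b * p * w
      regroup = solve-∀
      off-uK : ∀ u i → i ≢ u ℕ.* K → + (N C i) * (S i u * bellSum M (N ∸ i) (L ∸ u)) ≡ + 0
      off-uK u i i≢uK = trans (cong (λ y → + (N C i) * (y * bellSum M (N ∸ i) (L ∸ u)))
                                    (if-false (λ i≡uK → i≢uK (ℕ.≡ᵇ⇒≡ i _ i≡uK))))
                              (zeroᵐ (+ (N C i)) (bellSum M (N ∸ i) (L ∸ u)))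
      column : ∀ u → ∑[ i < suc N ] (+ (N C i) * (S i u * bellSum M (N ∸ i) (L ∸ u)))
                     ≡ (if u ℕ.* K ≤ᵇ N then coefficient u * bellSum M (N ∸ u ℕ.* K) (L ∸ u) else + 0)
      column u with u ℕ.* K ≤? N
      ... | yes uK≤N = begin
        ∑[ i < suc N ] (+ (N C i) * (S i u * bellSum M (N ∸ i) (L ∸ u)))
          ≡⟨ ∑-single (suc N) (u ℕ.* K) _ (s≤s uK≤N) (λ {i} _ → off-uK u i) ⟩
        + (N C (u ℕ.* K)) * (S (u ℕ.* K) u * W)
          ≡⟨ cong (λ y → + (N C (u ℕ.* K)) * (y * W)) (if-true (ℕ.≡⇒≡ᵇ (u ℕ.* K) _ refl)) ⟩
        + (N C (u ℕ.* K)) * (+ blocks M u * x ^ u * W)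
          ≡⟨ regroup (+ (N C (u ℕ.* K))) (+ blocks M u) (x ^ u) W ⟩
        coefficient u * W
          ≡⟨ if-true (ℕ.≤⇒≤ᵇ uK≤N) ⟨
        (if u ℕ.* K ≤ᵇ N then coefficient u * W else + 0) ∎
        where W = bellSum M (N ∸ u ℕ.* K) (L ∸ u)
      ... | no uK≰N = trans
        (∑-zero (suc N) (λ {i} i<1+N → off-uK u i (λ { refl → uK≰N (ℕ.≤-pred i<1+N) })))
        (sym (if-false (λ uK≤N → uK≰N (ℕ.≤ᵇ⇒≤ _ _ uK≤N))))

    truncate-suc : ∀ M j → single (suc M) (a (suc M)) j + truncate M j ≡ truncate (suc M) j
    truncate-suc M j with j ≟ suc M
    ... | yes refl = begin
      single (suc M) (a (suc M)) (suc M) + truncate M (suc M)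
        ≡⟨ cong₂ _+_ (if-true (ℕ.≡⇒≡ᵇ (suc M) (suc M) refl)) (if-false (λ 1+M≤M → ℕ.<-irrefl refl (ℕ.≤ᵇ⇒≤ _ M 1+M≤M))) ⟩
      a (suc M) + + 0
        ≡⟨ +-identityʳ _ ⟩
      a (suc M)
        ≡⟨ if-true (ℕ.≤⇒≤ᵇ (ℕ.≤-refl {suc M})) ⟨
      truncate (suc M) (suc M) ∎
      where open ≡-Reasoning
    ... | no j≢1+M = begin
      single (suc M) (a (suc M)) j + truncate M j
        ≡⟨ cong (_+ truncate M j) (if-false (λ j≡1+M → j≢1+M (ℕ.≡ᵇ⇒≡ j (suc M) j≡1+M))) ⟩
      + 0 + truncate M j
        ≡⟨ +-identityˡ _ ⟩
      truncate M j
        ≡⟨ cong (λ b → if b then a j else + 0) (T-reflects-elim (fromEquivalence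
             (λ j≤M → ℕ.≤⇒≤ᵇ (ℕ.m≤n⇒m≤1+n (ℕ.≤ᵇ⇒≤ j M j≤M)))
             (λ j≤1+M → ℕ.≤⇒≤ᵇ (ℕ.≤-pred (ℕ.≤∧≢⇒< (ℕ.≤ᵇ⇒≤ j (suc M) j≤1+M) j≢1+M))))) ⟩
      truncate (suc M) j ∎
      where open ≡-Reasoning

    bellSum-isBellMatrix : ∀ M → IsBellMatrix (truncate M) (bellSum M)
    bellSum-isBellMatrix zero = record
      { corner = refl ; row₀ = λ _ → refl ; column₀ = λ _ → refl
      ; recurrence = λ n d → sym (∑-zero (suc n) (λ {p} _ → zeroᵐ (+ (n C p)) (bellSum 0 (n ∸ p) d))) }
      where
      zeroᵐ : ∀ c y → c * + 0 * y ≡ + 0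
      zeroᵐ = solve-∀
    bellSum-isBellMatrix (suc M) = IsBellMatrix-resp (truncate-suc M) (λ n m → sym (bellSum-suc M n m))
      (Convolution.⊛-isBellMatrix (singleBell-isBellMatrix M (a (suc M))) (bellSum-isBellMatrix M))

  Bell-expansion : ∀ {a A} → IsBellMatrix a A → ∀ N m → A N m ≡ ∑part N N m (weight a N)
  Bell-expansion {a} isBell N =
    Bell-unique isBell (bellSum-isBellMatrix a N) N (λ j≤N → sym (if-true (ℕ.≤⇒≤ᵇ j≤N)))


open import Data.Nat using (ℕ; zero; suc; _≤_; _∸_; _!; s≤s)
open import Data.Nat.Combinatorics using (_C_)
open import Data.Integer using (ℤ; +_; -_; _*_)
open import Data.Integer.Properties using (*-zeroʳ; pos-*)
open import Data.List using (List; map; length)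
open import Data.Product using (_×_; _,_)
open import Relation.Binary.PropositionalEquality
open import Data.Integer.Tactic.RingSolver using (solve-∀)
open import Defs
open FiniteSum
open Stirling using (s-first-column)
open StirlingMatrix
open Jabotinsky using (IsJabotinsky; t-isJabotinsky; t-binomial-recurrence)
open Bell using (Jabotinsky⇒Bell)
open PartitionSum using (∑part; ∑part-cong-length; *-distribˡ-∑part)
open PartitionEnumeration using (sumℤ-partitions)
open BellExpansion using (weight; Bell-expansion)

-- Equals s m 1 for m ≥ 1 (s-first-column), but not for m = 0.
signedFactorial : ℕ → ℤ
signedFactorial m = negOnePow (suc m) * + ((m ∸ 1) !)

t-by-first-column : ∀ k n → t (suc n) (suc (suc k)) 1 ≡ ∑[ m < suc (suc n) ] (signedFactorial m * t (suc n) (suc k) m)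
t-by-first-column k n = trans (t-suc-right (suc k) (suc n) 1) (∑-cong-≗ (suc (suc n)) first-column)
  where
  A = s^ (suc k) (suc n)
  first-column : ∀ m → A m * s m 1 ≡ signedFactorial m * A m
  first-column zero    = trans (*-zeroʳ (A 0))
    (sym (trans (cong (signedFactorial 0 *_) (IsJabotinsky.column₀ (t-isJabotinsky k) n)) (*-zeroʳ (signedFactorial 0))))
  first-column (suc m) = trans (cong (A (suc m) *_) (s-first-column m)) (swap (A (suc m)) (negOnePow m) (+ (m !)))
    where
    swap : ∀ x σ y → x * (σ * y) ≡ - - σ * y * x
    swap = solve-∀

t-partition-expansion : ∀ k n → 2 ≤ k → 1 ≤ n →
  t n k 1 ≡ sumℤ (map (λ λs → negOnePow (suc (length λs)) * (+ g n λs) * prodℤ (map (λ i → t i (k ∸ 1) 1) λs))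
                      (partitions n))
t-partition-expansion (suc zero)    _         (s≤s ()) _
t-partition-expansion (suc (suc k)) N@(suc n) _        _ = begin
  t N (suc (suc k)) 1
    ≡⟨ t-by-first-column k n ⟩
  ∑[ m < suc N ] (signedFactorial m * t N (suc k) m)
    ≡⟨ ∑-cong-≗ (suc N) (λ m → cong (signedFactorial m *_) (Bell-expansion (Jabotinsky⇒Bell (t-isJabotinsky k)) N m)) ⟩
  ∑[ m < suc N ] (signedFactorial m * ∑part N N m (weight a N))
    ≡⟨ ∑-cong-≗ (suc N) (λ m → trans (*-distribˡ-∑part N N m (signedFactorial m) (weight a N))
                                     (∑part-cong-length N N m (H-by-length m))) ⟩
  ∑[ m < suc N ] ∑part N N m H
    ≡⟨ sumℤ-partitions N H ⟨
  sumℤ (map H (partitions N)) ∎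
  where
  open ≡-Reasoning
  a = λ i → t i (suc k) 1
  H : List ℕ → ℤ
  H λs = negOnePow (suc (length λs)) * (+ g N λs) * prodℤ (map a λs)
  regroup : ∀ σ x y p → σ * x * (y * p) ≡ σ * (x * y) * p
  regroup = solve-∀
  H-by-length : ∀ m xs → length xs ≡ m → signedFactorial m * weight a N xs ≡ H xs
  H-by-length _ xs refl =
    trans (regroup (negOnePow (suc (length xs))) (+ ((length xs ∸ 1) !)) (+ f N xs) (prodℤ (map a xs)))
          (cong (λ z → negOnePow (suc (length xs)) * z * prodℤ (map a xs)) (sym (pos-* ((length xs ∸ 1) !) (f N xs))))

mainTheorem7 :
    (∀ (k r n : ℕ) → 1 ≤ k → 1 ≤ r → r ≤ n →
      t n k r ≡ Σ[0…_] (n ∸ r) (λ p →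
        (+ ((n ∸ 1) C p)) * t (suc p) k 1 * t (n ∸ p ∸ 1) k (r ∸ 1)))
    × (∀ (k n : ℕ) → 2 ≤ k → 1 ≤ n →
      t n k 1 ≡ sumℤ (map (λ λs →
        negOnePow (suc (length λs)) * (+ g n λs) * prodℤ (map (λ i → t i (k ∸ 1) 1) λs))
        (partitions n)))
    × (∀ (k : ℕ) → 1 ≤ k → (t 0 k 0 ≡ + 1) × (t 1 k 1 ≡ + 1))
mainTheorem7 = t-binomial-recurrence , t-partition-expansion , λ k _ → t-corner k , t-one-one k
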